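{- Let $K\ge1$. Suppose $A_1,A_2,A_3,A_4\subseteq\mathbb{F}_2^n$ are non-empty sets with $\omega(A_1,A_2,A_3,A_4)\ge 1/K$, and suppose that $(A_1,A_2,A_3,A_4)$ is not coherently $\frac{1}{\sqrt{2K}}$-flat. Then for each $i=1,2,3,4$ there is a set $A_i'\subseteq A_i$ with $|A_i'|/|A_i|\gg K^{ -10}$ such that \[ \omega(A_1',A_2',A_3',A_4') \ge \frac{1}{K-10^{ -4}}.\]
   Context: $\mathbb{F}_2^n$ is the $n$-dimensional vector space over the two-element field. For non-empty sets, $\omega(A_1,\dots,A_4) := \frac{|\{(a_1,\dots,a_4)\in A_1\times\cdots\times A_4: a_1+a_2+a_3+a_4=0\}|}{(|A_1||A_2||A_3||A_4|)^{3/4}}$. For $f:\mathbb{F}_2^n\to\mathbb{R}$, $\hat f(\xi) := 2^{ -n}\sum_{x} f(x)(-1)^{\xi\cdot x}$. For non-empty $A$ and $0<\alpha\le1$, $\mathrm{Spec}_\alpha(A)=\{\xi: |\hat 1_A(\xi)|\ge \alpha|A|/2^n\}$. For $\delta>0$, a quadruple of non-empty sets $(A_1,\dots,A_4)$ is coherently $\delta$-flat if for every $\xi$ either $\xi\in\mathrm{Spec}_{9/10}(A_i)$ for all $i$, or $\xi\notin\mathrm{Spec}_\delta(A_i)$ for all $i$. $X\gg Y$ means $X\ge cY$ for an absolute constant $c>0$.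
   Formalization: The parameter K ranges over the rationals. -}

module Defs where

open import Data.Bool using (Bool; true; false; _xor_; _∧_; if_then_else_)
open import Data.Nat as ℕ using (ℕ; zero; suc)
open import Data.Integer as ℤ using (ℤ; +_)
open import Data.Rational as ℚ using (ℚ; 0ℚ; 1ℚ; _*_; _≤_; _/_)
open import Data.Vec using (Vec; []; _∷_; zipWith; replicate; foldr)
open import Data.List as List using (List; []; _∷_; _++_; map; concatMap; length; filter)
open import Relation.Binary.PropositionalEquality using (_≡_)
open import Relation.Nullary using (¬_)
open import Data.Product using (Σ; ∃; _×_)
open import Data.Sum using (_⊎_)
open import Data.Nat.Properties using (m^n>0)
import Data.Bool as B
import Data.Rational.Properties as ℚP
import Relation.Nullary

F₂^ : ℕ → Set
F₂^ n = Vec Bool n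

_⊕_ : ∀ {n} → F₂^ n → F₂^ n → F₂^ n
_⊕_ = zipWith _xor_
infixl 6 _⊕_

𝟘 : ∀ {n} → F₂^ n
𝟘 = replicate _ false

_·_ : ∀ {n} → F₂^ n → F₂^ n → Bool
ξ · x = foldr _ _xor_ false (zipWith _∧_ ξ x)

allVecs : (n : ℕ) → List (F₂^ n)
allVecs zero = [] ∷ []
allVecs (suc n) = map (false ∷_) (allVecs n) ++ map (true ∷_) (allVecs n)

Subset : ℕ → Set
Subset n = F₂^ n → Bool

card : ∀ {n} → Subset n → ℕ
card {n} A = length (filter (λ x → A x B.≟ true) (allVecs n))

NonEmpty : ∀ {n} → Subset n → Set
NonEmpty A = ∃ λ x → A x ≡ true

_⊆_ : ∀ {n} → Subset n → Subset n → Set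
B ⊆ A = ∀ x → B x ≡ true → A x ≡ true

ind : Bool → ℕ
ind true = 1
ind false = 0

isZero : ∀ {n} → F₂^ n → Bool
isZero [] = true
isZero (true ∷ x) = false
isZero (false ∷ x) = isZero x

sumL : ∀ {A : Set} → List A → (A → ℕ) → ℕ
sumL xs f = List.foldr ℕ._+_ 0 (map f xs)

additiveQuads : ∀ {n} → Subset n → Subset n → Subset n → Subset n → ℕ
additiveQuads {n} A₁ A₂ A₃ A₄ =
  sumL (allVecs n) λ a₁ → sumL (allVecs n) λ a₂ → sumL (allVecs n) λ a₃ → sumL (allVecs n) λ a₄ →
    ind (A₁ a₁ ∧ A₂ a₂ ∧ A₃ a₃ ∧ A₄ a₄ ∧ isZero (a₁ ⊕ a₂ ⊕ a₃ ⊕ a₄))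

ℕ→ℚ : ℕ → ℚ
ℕ→ℚ k = (+ k) / 1

_^ℚ_ : ℚ → ℕ → ℚ
q ^ℚ zero = 1ℚ
q ^ℚ suc k = q * (q ^ℚ k)

-- ω(A₁,…,A₄) ≥ 1/L  (for L > 0), i.e.  Q / (|A₁||A₂||A₃||A₄|)^{3/4} ≥ 1/L,
-- stated equivalently without fractional powers (everything is ≥ 0):
--   (|A₁||A₂||A₃||A₄|)³ ≤ (Q·L)⁴ .
ωAtLeastInv : ∀ {n} → Subset n → Subset n → Subset n → Subset n → ℚ → Set
ωAtLeastInv A₁ A₂ A₃ A₄ L =
  (ℕ→ℚ (card A₁ ℕ.* card A₂ ℕ.* card A₃ ℕ.* card A₄)) ^ℚ 3
    ≤ (ℕ→ℚ (additiveQuads A₁ A₂ A₃ A₄) * L) ^ℚ 4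

sign : Bool → ℚ
sign false = 1ℚ
sign true = ℚ.- 1ℚ

sumQ : ∀ {A : Set} → List A → (A → ℚ) → ℚ
sumQ xs f = List.foldr ℚ._+_ 0ℚ (map f xs)

fourier : ∀ {n} → Subset n → F₂^ n → ℚ
fourier {n} A ξ =
  sumQ (allVecs n) (λ x → (if A x then 1ℚ else 0ℚ) * sign (ξ · x)) * (1ℤ / (2 ℕ.^ n))
  where
  1ℤ = + 1
  instance _ = ℕ.>-nonZero (m^n>0 2 n)

-- ξ ∈ Spec_α(A), parametrised by α² (α ≥ 0):  |1̂_A(ξ)| ≥ α|A|/2ⁿ
-- written in the equivalent squared form  α²·(|A|/2ⁿ)² ≤ 1̂_A(ξ)².
InSpec : ∀ {n} → (α² : ℚ) → Subset n → F₂^ n → Set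
InSpec {n} α² A ξ =
  α² * ((ℕ→ℚ (card A) * (+ 1 / (2 ℕ.^ n))) ^ℚ 2) ≤ (fourier A ξ) ^ℚ 2
  where instance _ = ℕ.>-nonZero (m^n>0 2 n)

-- (A₁,…,A₄) coherently δ-flat, with δ given through δ²:
-- for every ξ, either ξ ∈ Spec_{9/10}(Aᵢ) for all i, or ξ ∉ Spec_δ(Aᵢ) for all i.
CoherentlyFlat : ∀ {n} → (δ² : ℚ) → Subset n → Subset n → Subset n → Subset n → Set
CoherentlyFlat {n} δ² A₁ A₂ A₃ A₄ = (ξ : F₂^ n) →
  (InSpec s A₁ ξ × InSpec s A₂ ξ × InSpec s A₃ ξ × InSpec s A₄ ξ)
  ⊎
  (¬ InSpec δ² A₁ ξ × ¬ InSpec δ² A₂ ξ × ¬ InSpec δ² A₃ ξ × ¬ InSpec δ² A₄ ξ)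
  where
  s : ℚ
  s = (+ 81) / 100   -- (9/10)²

-- total reciprocal on ℚ (value at 0 is irrelevant: only used at positive arguments)
recip : ℚ → ℚ
recip q with q ℚP.≟ 0ℚ
... | Relation.Nullary.yes _ = 0ℚ
... | Relation.Nullary.no q≢0 = ℚ.1/_ q {{ℚ.≢-nonZero q≢0}}

-- A character ξ at which flatness fails splits each Aᵢ into the slices
-- {x ∈ Aᵢ : ξ·x = 0} and {x ∈ Aᵢ : ξ·x = 1}, of densities pᵢ and 1 − pᵢ. The bias
-- fᵢ = 2pᵢ − 1 is 2ⁿ 1̂_{Aᵢ}(ξ)/|Aᵢ|, so fᵢ² ≥ 1/(2K) for some i and fⱼ² < 81/100
-- for some j. Additive quadruples only live on the eight slice quadruples whose
-- bits sum to zero, and each such piece has ω ≤ 1, so it carries at most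
-- (|A₁||A₂||A₃||A₄| X)^{3/4} quadruples, X being the product of its four densities.
-- An AM–GM inequality with a gap bounds X^{3/4} by a polynomial in the densities,
-- and these polynomials sum to 1 − G over the eight pieces, where, for a suitable
-- splitting of the indices into pairs {k, l} and {r, s},
-- G = (f_k² + f_l² − 2 f_k f_l f_r f_s)/32 ≥ f_i²/320. If no piece with all densities
-- at least (20K)⁻⁴ had ω ≥ 1/L, L = K − 10⁻⁴, then ω(A₁, …, A₄) ≥ 1/K would give
-- 1/K ≤ (1 − G)/L + 8/(20K)³, which fails since K G ≥ 1/640.

module Submission where

open import Level using (0ℓ)
open import Function using (_∘_)
open import Data.Bool as 𝔹 using (Bool; true; false; _xor_; _∧_; not; if_then_else_)
open import Data.Bool.Properties using (xor-∧-commutativeRing; xor-comm; xor-assoc)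
open import Data.Empty using (⊥-elim)
open import Data.Fin using (Fin; zero; suc)
open import Data.Fin.Properties using (¬∀⟶∃¬; all?) renaming (_≟_ to _≟ᶠ_)
open import Data.Integer as ℤ using (+_)
import Data.Integer.Properties as ℤₚ
open import Data.List using (List; []; _∷_; _++_; map; filter; length)
open import Data.List.Membership.Propositional using (_∈_)
open import Data.List.Membership.Propositional.Properties using (∈-map⁺; ∈-++⁺ˡ; ∈-++⁺ʳ)
open import Data.List.Relation.Unary.Any using (here; there)
open import Data.Vec using ([]; _∷_; lookup)
open import Data.Vec.Properties using (zipWith-comm; zipWith-assoc)
open import Data.Maybe using (Maybe; just; nothing)
open import Data.Nat as ℕ using (ℕ; zero; suc)
import Data.Nat.Properties as ℕₚ
open import Data.Product using (Σ; ∃; _×_; _,_; proj₁; proj₂; Σ-syntax)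
import Data.Product as Product
open import Data.Rational
open import Data.Rational.Properties
open import Data.Rational.Unnormalised as ℚᵘ using (mkℚᵘ; *≡*)
import Data.Rational.Unnormalised.Properties as ℚᵘ
import Data.Nat.Coprimality as Coprime
open import Data.Sum using (_⊎_; inj₁; inj₂)
open import Data.Unit using (tt)
open import Relation.Binary.PropositionalEquality
import Data.Nat.Tactic.RingSolver as ℕ-Solver
open import Relation.Nullary using (¬_; Dec; yes; no)
open import Relation.Nullary.Decidable using (map′; _⊎-dec_; _×-dec_; ¬?; decidable-stable)
open import Tactic.RingSolver using (solve-∀)
open import Tactic.RingSolver.Core.AlmostCommutativeRing using (AlmostCommutativeRing; fromCommutativeRing)

open import Defs

ℚ-ring : AlmostCommutativeRing 0ℓ 0ℓ
ℚ-ring = fromCommutativeRing +-*-commutativeRing zero?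
  where
  zero? : ∀ p → Maybe (0ℚ ≡ p)
  zero? p with p ≟ 0ℚ
  ... | yes p≡0 = just (sym p≡0)
  ... | no _    = nothing

𝔹-ring : AlmostCommutativeRing 0ℓ 0ℓ
𝔹-ring = fromCommutativeRing xor-∧-commutativeRing λ { false → just refl ; true → nothing }

*-nonNeg : ∀ {p q} → 0ℚ ≤ p → 0ℚ ≤ q → 0ℚ ≤ p * q
*-nonNeg {p} {q} 0≤p 0≤q =
  nonNegative⁻¹ (p * q) {{nonNeg*nonNeg⇒nonNeg p {{nonNegative 0≤p}} q {{nonNegative 0≤q}}}}

*-pos : ∀ {p q} → 0ℚ < p → 0ℚ < q → 0ℚ < p * q
*-pos {p} {q} 0<p 0<q = positive⁻¹ (p * q) {{pos*pos⇒pos p {{positive 0<p}} q {{positive 0<q}}}}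

square-nonNeg : ∀ p → 0ℚ ≤ p * p
square-nonNeg p with ≤-total 0ℚ p
... | inj₁ 0≤p = *-nonNeg 0≤p 0≤p
... | inj₂ p≤0 = nonNegative⁻¹ (p * p) {{nonPos*nonPos⇒nonPos p {{nonPositive p≤0}} p {{nonPositive p≤0}}}}

*-monoˡ-≤′ : ∀ {r p q} → 0ℚ ≤ r → p ≤ q → r * p ≤ r * q
*-monoˡ-≤′ {r} 0≤r = *-monoˡ-≤-nonNeg r {{nonNegative 0≤r}}

*-monoʳ-≤′ : ∀ {r p q} → 0ℚ ≤ r → p ≤ q → p * r ≤ q * r
*-monoʳ-≤′ {r} 0≤r = *-monoʳ-≤-nonNeg r {{nonNegative 0≤r}}

*-mono-≤-nonNeg : ∀ {p q r s} → 0ℚ ≤ p → p ≤ q → 0ℚ ≤ r → r ≤ s → p * r ≤ q * s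
*-mono-≤-nonNeg {p} {q} {r} {s} 0≤p p≤q 0≤r r≤s = begin
  p * r ≤⟨ *-monoʳ-≤′ 0≤r p≤q ⟩
  q * r ≤⟨ *-monoˡ-≤′ (≤-trans 0≤p p≤q) r≤s ⟩
  q * s ∎
  where open ≤-Reasoning

p+[q-p]≡q : ∀ p q → p + (q - p) ≡ q
p+[q-p]≡q = solve-∀ ℚ-ring

≤-by-difference : ∀ {p q} d → q - p ≡ d → 0ℚ ≤ d → p ≤ q
≤-by-difference {p} {q} d q-p≡d 0≤d = begin
  p            ≡⟨ sym (+-identityʳ p) ⟩
  p + 0ℚ       ≤⟨ +-monoʳ-≤ p (subst (0ℚ ≤_) (sym q-p≡d) 0≤d) ⟩
  p + (q - p)  ≡⟨ p+[q-p]≡q p q ⟩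
  q            ∎
  where open ≤-Reasoning

≤⇒0≤- : ∀ {p q} → p ≤ q → 0ℚ ≤ q - p
≤⇒0≤- {p} {q} p≤q = subst (_≤ q - p) (+-inverseʳ p) (+-monoˡ-≤ (- p) p≤q)

<-by-difference : ∀ {p q} d → q - p ≡ d → 0ℚ < d → p < q
<-by-difference {p} {q} d q-p≡d 0<d = begin-strict
  p            ≡⟨ sym (+-identityʳ p) ⟩
  p + 0ℚ       <⟨ +-monoʳ-< p (subst (0ℚ <_) (sym q-p≡d) 0<d) ⟩
  p + (q - p)  ≡⟨ p+[q-p]≡q p q ⟩
  q            ∎
  where open ≤-Reasoning

1≤⇒pos : ∀ {K} → 1ℚ ≤ K → 0ℚ < K
1≤⇒pos 1≤K = <-≤-trans (positive⁻¹ 1ℚ) 1≤K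

<⇒≱ : ∀ {p q} → p < q → ¬ (q ≤ p)
<⇒≱ p<q q≤p = <-irrefl refl (<-≤-trans p<q q≤p)

*-≤ˡ : ∀ {x y} → 0ℚ ≤ x → y ≤ 1ℚ → x * y ≤ x
*-≤ˡ {x} {y} 0≤x y≤1 = subst (x * y ≤_) (*-identityʳ x) (*-monoˡ-≤′ 0≤x y≤1)

*-≤ʳ : ∀ {x y} → x ≤ 1ℚ → 0ℚ ≤ y → x * y ≤ y
*-≤ʳ {x} {y} x≤1 0≤y = subst (x * y ≤_) (*-identityˡ y) (*-monoʳ-≤′ 0≤y x≤1)

^-nonNeg : ∀ k {p} → 0ℚ ≤ p → 0ℚ ≤ p ^ℚ k
^-nonNeg zero    0≤p = ≤ᵇ⇒≤ tt
^-nonNeg (suc k) 0≤p = *-nonNeg 0≤p (^-nonNeg k 0≤p)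

^-pos : ∀ k {p} → 0ℚ < p → 0ℚ < p ^ℚ k
^-pos zero    0<p = positive⁻¹ 1ℚ
^-pos (suc k) 0<p = *-pos 0<p (^-pos k 0<p)

^-mono-≤ : ∀ k {p q} → 0ℚ ≤ p → p ≤ q → p ^ℚ k ≤ q ^ℚ k
^-mono-≤ zero    0≤p p≤q = ≤-refl
^-mono-≤ (suc k) 0≤p p≤q = *-mono-≤-nonNeg 0≤p p≤q (^-nonNeg k 0≤p) (^-mono-≤ k 0≤p p≤q)

^-mono-< : ∀ k {p q} → 0ℚ ≤ p → p < q → p ^ℚ suc k < q ^ℚ suc k
^-mono-< k {p} {q} 0≤p p<q = begin-strict
  p * p ^ℚ k ≤⟨ *-monoˡ-≤′ 0≤p (^-mono-≤ k 0≤p (<⇒≤ p<q)) ⟩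
  p * q ^ℚ k <⟨ *-monoˡ-<-pos (q ^ℚ k) {{positive (^-pos k (≤-<-trans 0≤p p<q))}} p<q ⟩
  q * q ^ℚ k ∎
  where open ≤-Reasoning

^-cancel-≤ : ∀ k {p q} → 0ℚ ≤ q → p ^ℚ suc k ≤ q ^ℚ suc k → p ≤ q
^-cancel-≤ k {p} {q} 0≤q pᵏ≤qᵏ with p ≤? q
... | yes p≤q = p≤q
... | no p≰q  = ⊥-elim (<⇒≱ (^-mono-< k 0≤q (≰⇒> p≰q)) pᵏ≤qᵏ)

^-cancel-< : ∀ k {p q} → 0ℚ ≤ q → p ^ℚ k < q ^ℚ k → p < q
^-cancel-< k {p} {q} 0≤q pᵏ<qᵏ with p <? q
... | yes p<q = p<q
... | no p≮q  = ⊥-elim (<⇒≱ pᵏ<qᵏ (^-mono-≤ k 0≤q (≮⇒≥ p≮q)))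

^-distrib-* : ∀ k p q → (p * q) ^ℚ k ≡ p ^ℚ k * q ^ℚ k
^-distrib-* zero    p q = refl
^-distrib-* (suc k) p q = begin
  p * q * (p * q) ^ℚ k        ≡⟨ cong (p * q *_) (^-distrib-* k p q) ⟩
  p * q * (p ^ℚ k * q ^ℚ k)   ≡⟨ interchange p q (p ^ℚ k) (q ^ℚ k) ⟩
  p * p ^ℚ k * (q * q ^ℚ k)   ∎
  where
  open ≡-Reasoning
  interchange : ∀ a b c d → a * b * (c * d) ≡ a * c * (b * d)
  interchange = solve-∀ ℚ-ring

0^suc≡0 : ∀ k → 0ℚ ^ℚ suc k ≡ 0ℚ
0^suc≡0 k = *-zeroˡ (0ℚ ^ℚ k)

square-≤⇒≤ : ∀ {t c} → 0ℚ ≤ c → t * t ≤ c * c → t ≤ c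
square-≤⇒≤ {t} {c} 0≤c t²≤c² = ^-cancel-≤ 1 0≤c (subst₂ _≤_ (square t) (square c) t²≤c²)
  where
  square : ∀ x → x * x ≡ x * (x * 1ℚ)
  square = solve-∀ ℚ-ring

^-≥1 : ∀ k {K} → 1ℚ ≤ K → 1ℚ ≤ K ^ℚ k
^-≥1 zero    1≤K = ≤-refl
^-≥1 (suc k) {K} 1≤K =
  subst (_≤ K * K ^ℚ k) (*-identityˡ 1ℚ) (*-mono-≤-nonNeg (≤ᵇ⇒≤ tt) 1≤K (≤ᵇ⇒≤ tt) (^-≥1 k 1≤K))

-- The bound xᵏ ≤ cᵏ R says x ≤ c R^{1/k}; such bounds add up.
private
  ^-root-+-ordered : ∀ k {R x₁ x₂ c₁ c₂} → 0ℚ ≤ x₁ → 0ℚ ≤ x₂ → 0ℚ ≤ c₁ → 0ℚ ≤ c₂ →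
                     x₂ * c₁ ≤ x₁ * c₂ → x₁ ^ℚ suc k ≤ c₁ ^ℚ suc k * R → x₂ ^ℚ suc k ≤ c₂ ^ℚ suc k * R →
                     (x₁ + x₂) ^ℚ suc k ≤ (c₁ + c₂) ^ℚ suc k * R
  ^-root-+-ordered k {R} {x₁} {x₂} {c₁} {c₂} 0≤x₁ 0≤x₂ 0≤c₁ 0≤c₂ x₂c₁≤x₁c₂ h₁ h₂ with 0ℚ <? c₁
  ... | yes 0<c₁ = *-cancelʳ-≤-pos (c₁ ^ℚ n) {{positive (^-pos n 0<c₁)}} (begin
    (x₁ + x₂) ^ℚ n * c₁ ^ℚ n       ≡⟨ sym (^-distrib-* n (x₁ + x₂) c₁) ⟩
    ((x₁ + x₂) * c₁) ^ℚ n          ≤⟨ ^-mono-≤ n (*-nonNeg (+-mono-≤ 0≤x₁ 0≤x₂) 0≤c₁) mediant ⟩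
    (x₁ * (c₁ + c₂)) ^ℚ n          ≡⟨ ^-distrib-* n x₁ (c₁ + c₂) ⟩
    x₁ ^ℚ n * (c₁ + c₂) ^ℚ n       ≤⟨ *-monoʳ-≤′ (^-nonNeg n (+-mono-≤ 0≤c₁ 0≤c₂)) h₁ ⟩
    c₁ ^ℚ n * R * (c₁ + c₂) ^ℚ n   ≡⟨ rearrange (c₁ ^ℚ n) R ((c₁ + c₂) ^ℚ n) ⟩
    (c₁ + c₂) ^ℚ n * R * c₁ ^ℚ n   ∎)
    where
    n = suc k
    open ≤-Reasoning
    rearrange : ∀ a b c → a * b * c ≡ c * b * a
    rearrange = solve-∀ ℚ-ring
    difference : ∀ x₁ x₂ c₁ c₂ → x₁ * (c₁ + c₂) - (x₁ + x₂) * c₁ ≡ x₁ * c₂ - x₂ * c₁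
    difference = solve-∀ ℚ-ring
    mediant : (x₁ + x₂) * c₁ ≤ x₁ * (c₁ + c₂)
    mediant = ≤-by-difference _ (difference x₁ x₂ c₁ c₂) (≤⇒0≤- x₂c₁≤x₁c₂)
  ... | no 0≮c₁ = subst₂ (λ x c → x ^ℚ suc k ≤ c ^ℚ suc k * R) (sym x₁+x₂≡x₂) (sym c₁+c₂≡c₂) h₂
    where
    c₁≡0 : c₁ ≡ 0ℚ
    c₁≡0 = ≤-antisym (≮⇒≥ 0≮c₁) 0≤c₁
    x₁≡0 : x₁ ≡ 0ℚ
    x₁≡0 = ≤-antisym (^-cancel-≤ k ≤-refl (begin
      x₁ ^ℚ suc k               ≤⟨ h₁ ⟩
      c₁ ^ℚ suc k * R           ≡⟨ cong (λ c → c ^ℚ suc k * R) c₁≡0 ⟩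
      0ℚ ^ℚ suc k * R           ≡⟨ cong (_* R) (0^suc≡0 k) ⟩
      0ℚ * R                    ≡⟨ *-zeroˡ R ⟩
      0ℚ                        ≡⟨ sym (0^suc≡0 k) ⟩
      0ℚ ^ℚ suc k               ∎)) 0≤x₁
      where open ≤-Reasoning
    x₁+x₂≡x₂ : x₁ + x₂ ≡ x₂
    x₁+x₂≡x₂ = trans (cong (_+ x₂) x₁≡0) (+-identityˡ x₂)
    c₁+c₂≡c₂ : c₁ + c₂ ≡ c₂
    c₁+c₂≡c₂ = trans (cong (_+ c₂) c₁≡0) (+-identityˡ c₂)

^-root-+ : ∀ k {R x₁ x₂ c₁ c₂} → 0ℚ ≤ x₁ → 0ℚ ≤ x₂ → 0ℚ ≤ c₁ → 0ℚ ≤ c₂ →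
           x₁ ^ℚ suc k ≤ c₁ ^ℚ suc k * R → x₂ ^ℚ suc k ≤ c₂ ^ℚ suc k * R →
           (x₁ + x₂) ^ℚ suc k ≤ (c₁ + c₂) ^ℚ suc k * R
^-root-+ k {R} {x₁} {x₂} {c₁} {c₂} 0≤x₁ 0≤x₂ 0≤c₁ 0≤c₂ h₁ h₂ with ≤-total (x₂ * c₁) (x₁ * c₂)
... | inj₁ x₂c₁≤x₁c₂ = ^-root-+-ordered k 0≤x₁ 0≤x₂ 0≤c₁ 0≤c₂ x₂c₁≤x₁c₂ h₁ h₂
... | inj₂ x₁c₂≤x₂c₁ = subst₂ (λ x c → x ^ℚ suc k ≤ c ^ℚ suc k * R) (+-comm x₂ x₁) (+-comm c₂ c₁)
  (^-root-+-ordered k 0≤x₂ 0≤x₁ 0≤c₂ 0≤c₁ x₁c₂≤x₂c₁ h₂ h₁)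

module _ {A : Set} where

  sumQ-nonNeg : ∀ (xs : List A) {f} → (∀ a → 0ℚ ≤ f a) → 0ℚ ≤ sumQ xs f
  sumQ-nonNeg []       0≤f = ≤-refl
  sumQ-nonNeg (x ∷ xs) 0≤f = +-mono-≤ (0≤f x) (sumQ-nonNeg xs 0≤f)

  sumQ-*ˡ : ∀ (xs : List A) r f → sumQ xs (λ a → r * f a) ≡ r * sumQ xs f
  sumQ-*ˡ []       r f = sym (*-zeroʳ r)
  sumQ-*ˡ (x ∷ xs) r f = trans (cong (λ s → r * f x + s) (sumQ-*ˡ xs r f)) (sym (*-distribˡ-+ r (f x) (sumQ xs f)))

  sumQ-+ : ∀ (xs : List A) f g → sumQ xs (λ a → f a + g a) ≡ sumQ xs f + sumQ xs g
  sumQ-+ []       f g = refl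
  sumQ-+ (x ∷ xs) f g = trans (cong (λ s → f x + g x + s) (sumQ-+ xs f g)) (medial (f x) (g x) (sumQ xs f) (sumQ xs g))
    where
    medial : ∀ a b c d → a + b + (c + d) ≡ a + c + (b + d)
    medial = solve-∀ ℚ-ring

  sumQ-root : ∀ k (xs : List A) {R x c} → (∀ a → 0ℚ ≤ x a) → (∀ a → 0ℚ ≤ c a) →
              (∀ a → x a ^ℚ suc k ≤ c a ^ℚ suc k * R) →
              sumQ xs x ^ℚ suc k ≤ sumQ xs c ^ℚ suc k * R
  sumQ-root k []       {R} 0≤x 0≤c h = ≤-reflexive (begin
    0ℚ ^ℚ suc k        ≡⟨ 0^suc≡0 k ⟩
    0ℚ                 ≡⟨ sym (*-zeroˡ R) ⟩
    0ℚ * R             ≡⟨ cong (_* R) (sym (0^suc≡0 k)) ⟩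
    0ℚ ^ℚ suc k * R    ∎)
    where open ≡-Reasoning
  sumQ-root k (x ∷ xs) 0≤x 0≤c h =
    ^-root-+ k (0≤x x) (sumQ-nonNeg xs 0≤x) (0≤c x) (sumQ-nonNeg xs 0≤c) (h x) (sumQ-root k xs 0≤x 0≤c h)

module _ {A : Set} where

  sumL-cong : ∀ (xs : List A) {f g} → (∀ a → f a ≡ g a) → sumL xs f ≡ sumL xs g
  sumL-cong []       f≡g = refl
  sumL-cong (x ∷ xs) f≡g = cong₂ ℕ._+_ (f≡g x) (sumL-cong xs f≡g)

  sumL-mono : ∀ (xs : List A) {f g} → (∀ a → f a ℕ.≤ g a) → sumL xs f ℕ.≤ sumL xs g
  sumL-mono []       f≤g = ℕ.z≤n
  sumL-mono (x ∷ xs) f≤g = ℕₚ.+-mono-≤ (f≤g x) (sumL-mono xs f≤g)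

  sumL-zero : ∀ (xs : List A) → sumL xs (λ _ → 0) ≡ 0
  sumL-zero []       = refl
  sumL-zero (x ∷ xs) = sumL-zero xs

  sumL-+ : ∀ (xs : List A) f g → sumL xs (λ a → f a ℕ.+ g a) ≡ sumL xs f ℕ.+ sumL xs g
  sumL-+ []       f g = refl
  sumL-+ (x ∷ xs) f g = trans (cong (f x ℕ.+ g x ℕ.+_) (sumL-+ xs f g)) (medial (f x) (g x) (sumL xs f) (sumL xs g))
    where
    medial : ∀ a b c d → a ℕ.+ b ℕ.+ (c ℕ.+ d) ≡ a ℕ.+ c ℕ.+ (b ℕ.+ d)
    medial = ℕ-Solver.solve-∀

  sumL-*ˡ : ∀ (xs : List A) k f → sumL xs (λ a → k ℕ.* f a) ≡ k ℕ.* sumL xs f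
  sumL-*ˡ []       k f = sym (ℕₚ.*-zeroʳ k)
  sumL-*ˡ (x ∷ xs) k f = trans (cong (k ℕ.* f x ℕ.+_) (sumL-*ˡ xs k f)) (sym (ℕₚ.*-distribˡ-+ k (f x) (sumL xs f)))

  sumL-*ʳ : ∀ (xs : List A) f k → sumL xs (λ a → f a ℕ.* k) ≡ sumL xs f ℕ.* k
  sumL-*ʳ xs f k = trans (sumL-cong xs (λ a → ℕₚ.*-comm (f a) k)) (trans (sumL-*ˡ xs k f) (ℕₚ.*-comm k (sumL xs f)))

  sumL-++ : ∀ (xs ys : List A) f → sumL (xs ++ ys) f ≡ sumL xs f ℕ.+ sumL ys f
  sumL-++ []       ys f = refl
  sumL-++ (x ∷ xs) ys f = trans (cong (f x ℕ.+_) (sumL-++ xs ys f)) (sym (ℕₚ.+-assoc (f x) (sumL xs f) (sumL ys f)))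

  ∈⇒≤sumL : ∀ {x xs} (f : A → ℕ) → x ∈ xs → f x ℕ.≤ sumL xs f
  ∈⇒≤sumL f (here refl)  = ℕₚ.m≤m+n _ _
  ∈⇒≤sumL f (there x∈xs) = ℕₚ.≤-trans (∈⇒≤sumL f x∈xs) (ℕₚ.m≤n+m _ _)

sumL-map : ∀ {A B : Set} (xs : List A) (g : A → B) f → sumL (map g xs) f ≡ sumL xs (f ∘ g)
sumL-map []       g f = refl
sumL-map (x ∷ xs) g f = cong (f (g x) ℕ.+_) (sumL-map xs g f)

sumL-comm : ∀ {A B : Set} (xs : List A) (ys : List B) (f : A → B → ℕ) →
            sumL xs (λ x → sumL ys (f x)) ≡ sumL ys (λ y → sumL xs (λ x → f x y))
sumL-comm []       ys f = sym (sumL-zero ys)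
sumL-comm (x ∷ xs) ys f = trans (cong (sumL ys (f x) ℕ.+_) (sumL-comm xs ys f)) (sym (sumL-+ ys (f x) (λ y → sumL xs (λ x → f x y))))

sumL-product : ∀ {A B : Set} (xs : List A) (ys : List B) (f : A → ℕ) (g : B → ℕ) →
               sumL xs (λ x → sumL ys (λ y → f x ℕ.* g y)) ≡ sumL xs f ℕ.* sumL ys g
sumL-product xs ys f g = trans (sumL-cong xs (λ x → sumL-*ˡ ys (f x) g)) (sumL-*ʳ xs f (sumL ys g))

private
  toℚᵘ-ℕ→ℚ : ∀ k → toℚᵘ (ℕ→ℚ k) ≡ mkℚᵘ (+ k) 0
  toℚᵘ-ℕ→ℚ k = cong toℚᵘ (normalize-coprime (Coprime.sym (Coprime.1-coprimeTo k)))

  ℕ→ℚ-homo : ∀ (f : ℕ → ℕ → ℕ) (g : ℚᵘ.ℚᵘ → ℚᵘ.ℚᵘ → ℚᵘ.ℚᵘ) (h : ℚ → ℚ → ℚ) →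
             (∀ p q → toℚᵘ (h p q) ℚᵘ.≃ g (toℚᵘ p) (toℚᵘ q)) →
             (∀ a b → mkℚᵘ (+ f a b) 0 ℚᵘ.≃ g (mkℚᵘ (+ a) 0) (mkℚᵘ (+ b) 0)) →
             ∀ a b → ℕ→ℚ (f a b) ≡ h (ℕ→ℚ a) (ℕ→ℚ b)
  ℕ→ℚ-homo f g h toℚᵘ-homo on-integers a b = toℚᵘ-injective (ℚᵘ.≃-trans
    (ℚᵘ.≃-reflexive (toℚᵘ-ℕ→ℚ (f a b)))
    (ℚᵘ.≃-trans
      (subst₂ (λ x y → mkℚᵘ (+ f a b) 0 ℚᵘ.≃ g x y) (sym (toℚᵘ-ℕ→ℚ a)) (sym (toℚᵘ-ℕ→ℚ b)) (on-integers a b))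
      (ℚᵘ.≃-sym (toℚᵘ-homo (ℕ→ℚ a) (ℕ→ℚ b)))))

ℕ→ℚ-+ : ∀ a b → ℕ→ℚ (a ℕ.+ b) ≡ ℕ→ℚ a + ℕ→ℚ b
ℕ→ℚ-+ = ℕ→ℚ-homo ℕ._+_ ℚᵘ._+_ _+_ toℚᵘ-homo-+ λ a b → *≡* (cong (ℤ._* + 1)
  (trans (ℤₚ.pos-+ a b) (sym (cong₂ ℤ._+_ (ℤₚ.*-identityʳ (+ a)) (ℤₚ.*-identityʳ (+ b))))))

ℕ→ℚ-* : ∀ a b → ℕ→ℚ (a ℕ.* b) ≡ ℕ→ℚ a * ℕ→ℚ b
ℕ→ℚ-* = ℕ→ℚ-homo ℕ._*_ ℚᵘ._*_ _*_ toℚᵘ-homo-* λ a b → *≡* (cong (ℤ._* + 1) (ℤₚ.pos-* a b))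

ℕ→ℚ-mono-≤ : ∀ {a b} → a ℕ.≤ b → ℕ→ℚ a ≤ ℕ→ℚ b
ℕ→ℚ-mono-≤ {a} {b} a≤b = toℚᵘ-cancel-≤ (subst₂ ℚᵘ._≤_ (sym (toℚᵘ-ℕ→ℚ a)) (sym (toℚᵘ-ℕ→ℚ b))
  (ℚᵘ.*≤* (subst₂ ℤ._≤_ (sym (ℤₚ.*-identityʳ (+ a))) (sym (ℤₚ.*-identityʳ (+ b))) (ℤ.+≤+ a≤b))))

ℕ→ℚ-nonNeg : ∀ k → 0ℚ ≤ ℕ→ℚ k
ℕ→ℚ-nonNeg k = ℕ→ℚ-mono-≤ {0} {k} ℕ.z≤n

ℕ→ℚ-^ : ∀ m k → ℕ→ℚ (m ℕ.^ k) ≡ ℕ→ℚ m ^ℚ k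
ℕ→ℚ-^ m zero    = refl
ℕ→ℚ-^ m (suc k) = trans (ℕ→ℚ-* m (m ℕ.^ k)) (cong (ℕ→ℚ m *_) (ℕ→ℚ-^ m k))

ℕ→ℚ-sumL : ∀ {A : Set} (xs : List A) f → ℕ→ℚ (sumL xs f) ≡ sumQ xs (ℕ→ℚ ∘ f)
ℕ→ℚ-sumL []       f = refl
ℕ→ℚ-sumL (x ∷ xs) f = trans (ℕ→ℚ-+ (f x) (sumL xs f)) (cong (λ s → ℕ→ℚ (f x) + s) (ℕ→ℚ-sumL xs f))

∈-allVecs : ∀ {n} (x : F₂^ n) → x ∈ allVecs n
∈-allVecs []          = here refl
∈-allVecs (false ∷ x) = ∈-++⁺ˡ (∈-map⁺ (false ∷_) (∈-allVecs x))
∈-allVecs (true ∷ x)  = ∈-++⁺ʳ (map (false ∷_) (allVecs _)) (∈-map⁺ (true ∷_) (∈-allVecs x))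

sumL-allVecs : ∀ n f → sumL (allVecs (suc n)) f ≡
               sumL (allVecs n) (f ∘ (false ∷_)) ℕ.+ sumL (allVecs n) (f ∘ (true ∷_))
sumL-allVecs n f = trans (sumL-++ (map (false ∷_) (allVecs n)) _ f)
                         (cong₂ ℕ._+_ (sumL-map (allVecs n) (false ∷_) f) (sumL-map (allVecs n) (true ∷_) f))

∃? : ∀ n {P : F₂^ n → Set} → (∀ x → Dec (P x)) → Dec (∃ P)
∃? zero    P? = map′ ([] ,_) (λ { ([] , p) → p }) (P? [])
∃? (suc n) {P} P? = map′ cons uncons (∃? n (P? ∘ (false ∷_)) ⊎-dec ∃? n (P? ∘ (true ∷_)))
  where
  cons : (∃ λ x → P (false ∷ x)) ⊎ (∃ λ x → P (true ∷ x)) → ∃ P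
  cons (inj₁ (x , p)) = false ∷ x , p
  cons (inj₂ (x , p)) = true ∷ x , p
  uncons : ∃ P → (∃ λ x → P (false ∷ x)) ⊎ (∃ λ x → P (true ∷ x))
  uncons (false ∷ x , p) = inj₁ (x , p)
  uncons (true ∷ x , p)  = inj₂ (x , p)

¬∀⇒∃¬ : ∀ n {P : F₂^ n → Set} → (∀ x → Dec (P x)) → ¬ (∀ x → P x) → ∃ λ x → ¬ P x
¬∀⇒∃¬ n P? ¬∀P with ∃? n (¬? ∘ P?)
... | yes counterexample = counterexample
... | no  none           = ⊥-elim (¬∀P λ x → decidable-stable (P? x) λ ¬Px → none (x , ¬Px))

⊕-comm : ∀ {n} (x y : F₂^ n) → x ⊕ y ≡ y ⊕ x
⊕-comm = zipWith-comm xor-comm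

⊕-assoc : ∀ {n} (x y z : F₂^ n) → x ⊕ y ⊕ z ≡ x ⊕ (y ⊕ z)
⊕-assoc = zipWith-assoc xor-assoc

·-⊕ : ∀ {n} (ξ x y : F₂^ n) → ξ · (x ⊕ y) ≡ ξ · x xor ξ · y
·-⊕ []      []      []      = refl
·-⊕ (c ∷ ξ) (a ∷ x) (b ∷ y) = trans (cong ((c ∧ (a xor b)) xor_) (·-⊕ ξ x y)) (distrib c a b (ξ · x) (ξ · y))
  where
  distrib : ∀ c a b u v → (c ∧ (a xor b)) xor (u xor v) ≡ ((c ∧ a) xor u) xor ((c ∧ b) xor v)
  distrib = solve-∀ 𝔹-ring

isZero-⊕ : ∀ {n} (x y : F₂^ n) → isZero (x ⊕ y) ≡ true → x ≡ y
isZero-⊕ []          []          _ = refl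
isZero-⊕ (false ∷ x) (false ∷ y) z = cong (false ∷_) (isZero-⊕ x y z)
isZero-⊕ (true ∷ x)  (true ∷ y)  z = cong (true ∷_) (isZero-⊕ x y z)
isZero-⊕ (false ∷ x) (true ∷ y)  ()
isZero-⊕ (true ∷ x)  (false ∷ y) ()

sumL-isZero : ∀ {n} (w : F₂^ n) → sumL (allVecs n) (λ x → ind (isZero (w ⊕ x))) ≡ 1
sumL-isZero []          = refl
sumL-isZero {suc n} (false ∷ w) = trans (sumL-allVecs n _) (cong₂ ℕ._+_ (sumL-isZero w) (sumL-zero (allVecs n)))
sumL-isZero {suc n} (true ∷ w)  = trans (sumL-allVecs n _) (cong₂ ℕ._+_ (sumL-zero (allVecs n)) (sumL-isZero w))

card-sum : ∀ {n} (A : Subset n) → card A ≡ sumL (allVecs n) (ind ∘ A)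
card-sum {n} A = length-filter (allVecs n)
  where
  length-filter : ∀ xs → length (filter (λ x → A x 𝔹.≟ true) xs) ≡ sumL xs (ind ∘ A)
  length-filter []       = refl
  length-filter (x ∷ xs) with A x
  ... | true  = cong suc (length-filter xs)
  ... | false = length-filter xs

card-pos : ∀ {n} (A : Subset n) → NonEmpty A → 0ℚ < ℕ→ℚ (card A)
card-pos A (x , Ax≡true) = <-≤-trans (positive⁻¹ 1ℚ) (ℕ→ℚ-mono-≤ (subst₂ ℕ._≤_ (cong ind Ax≡true) (sym (card-sum A))
  (∈⇒≤sumL (ind ∘ A) (∈-allVecs x))))

agree : Bool → Bool → Bool
agree x y = not (x xor y)

slice : ∀ {n} → Subset n → F₂^ n → Bool → Subset n
slice A ξ b x = A x ∧ agree (ξ · x) b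

slice-⊆ : ∀ {n} (A : Subset n) ξ b → slice A ξ b ⊆ A
slice-⊆ A ξ b x Bx≡true with A x
... | true = refl

card-slices : ∀ {n} (A : Subset n) ξ → card A ≡ card (slice A ξ false) ℕ.+ card (slice A ξ true)
card-slices {n} A ξ = begin
  card A                                                               ≡⟨ card-sum A ⟩
  sumL (allVecs n) (ind ∘ A)                                           ≡⟨ sumL-cong (allVecs n) (λ x → split (A x) (ξ · x)) ⟩
  sumL (allVecs n) (λ x → ind (slice A ξ false x) ℕ.+ ind (slice A ξ true x))  ≡⟨ sumL-+ (allVecs n) _ _ ⟩
  sumL (allVecs n) (ind ∘ slice A ξ false) ℕ.+ sumL (allVecs n) (ind ∘ slice A ξ true)
    ≡⟨ sym (cong₂ ℕ._+_ (card-sum (slice A ξ false)) (card-sum (slice A ξ true))) ⟩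
  card (slice A ξ false) ℕ.+ card (slice A ξ true)                     ∎
  where
  open ≡-Reasoning
  split : ∀ a c → ind a ≡ ind (a ∧ agree c false) ℕ.+ ind (a ∧ agree c true)
  split false c     = refl
  split true  false = refl
  split true  true  = refl

2⁻ⁿ : ℕ → ℚ
2⁻ⁿ n = + 1 / (2 ℕ.^ n)
  where instance _ = ℕ.>-nonZero (ℕₚ.m^n>0 2 n)

fourier-slices : ∀ {n} (A : Subset n) ξ →
  fourier A ξ ≡ (ℕ→ℚ (card (slice A ξ false)) - ℕ→ℚ (card (slice A ξ true))) * 2⁻ⁿ n
fourier-slices {n} A ξ = cong (_* 2⁻ⁿ n) (begin
  sumQ (allVecs n) signed
    ≡⟨ signed-sum (allVecs n) ⟩
  ℕ→ℚ (sumL (allVecs n) (ind ∘ slice A ξ false)) - ℕ→ℚ (sumL (allVecs n) (ind ∘ slice A ξ true))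
    ≡⟨ sym (cong₂ (λ a b → ℕ→ℚ a - ℕ→ℚ b) (card-sum (slice A ξ false)) (card-sum (slice A ξ true))) ⟩
  ℕ→ℚ (card (slice A ξ false)) - ℕ→ℚ (card (slice A ξ true)) ∎)
  where
  open ≡-Reasoning
  signed : F₂^ n → ℚ
  signed x = (if A x then 1ℚ else 0ℚ) * sign (ξ · x)
  signed-term : ∀ a c → (if a then 1ℚ else 0ℚ) * sign c ≡ ℕ→ℚ (ind (a ∧ agree c false)) - ℕ→ℚ (ind (a ∧ agree c true))
  signed-term false false = refl
  signed-term false true  = refl
  signed-term true  false = refl
  signed-term true  true  = refl
  regroup : ∀ a b c d → (a - b) + (c - d) ≡ (a + c) - (b + d)
  regroup = solve-∀ ℚ-ring
  signed-sum : ∀ xs → sumQ xs signed ≡ ℕ→ℚ (sumL xs (ind ∘ slice A ξ false)) - ℕ→ℚ (sumL xs (ind ∘ slice A ξ true))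
  signed-sum []       = refl
  signed-sum (x ∷ xs) = begin
    signed x + sumQ xs signed
      ≡⟨ cong₂ _+_ (signed-term (A x) (ξ · x)) (signed-sum xs) ⟩
    (ℕ→ℚ (ind (slice A ξ false x)) - ℕ→ℚ (ind (slice A ξ true x)))
      + (ℕ→ℚ (sumL xs (ind ∘ slice A ξ false)) - ℕ→ℚ (sumL xs (ind ∘ slice A ξ true)))
      ≡⟨ regroup (ℕ→ℚ (ind (slice A ξ false x))) (ℕ→ℚ (ind (slice A ξ true x))) _ _ ⟩
    (ℕ→ℚ (ind (slice A ξ false x)) + ℕ→ℚ (sumL xs (ind ∘ slice A ξ false)))
      - (ℕ→ℚ (ind (slice A ξ true x)) + ℕ→ℚ (sumL xs (ind ∘ slice A ξ true)))
      ≡⟨ sym (cong₂ _-_ (ℕ→ℚ-+ (ind (slice A ξ false x)) _) (ℕ→ℚ-+ (ind (slice A ξ true x)) _)) ⟩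
    ℕ→ℚ (sumL (x ∷ xs) (ind ∘ slice A ξ false)) - ℕ→ℚ (sumL (x ∷ xs) (ind ∘ slice A ξ true)) ∎

Idx : Set
Idx = Fin 4

pattern i₁ = zero
pattern i₂ = suc zero
pattern i₃ = suc (suc zero)
pattern i₄ = suc (suc (suc zero))

record Quad (A : Set) : Set where
  constructor ⟨_,_,_,_⟩
  field
    at₁ at₂ at₃ at₄ : A

open Quad

infixl 9 _!_
_!_ : ∀ {A} → Quad A → Idx → A
q ! i₁ = at₁ q
q ! i₂ = at₂ q
q ! i₃ = at₃ q
q ! i₄ = at₄ q

-- The slice quadruples that can contain additive quadruples are those whose
-- bits b₁, b₂, b₃, b₄ sum to zero; they are indexed by b ∈ F₂³.  Defined
-- through lookup so that the four bits are available even for a variable b.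
evenExtension : F₂^ 3 → Quad Bool
evenExtension b = ⟨ b₁ , b₂ , b₃ , b₁ xor b₂ xor b₃ ⟩
  where
  b₁ = lookup b zero
  b₂ = lookup b (suc zero)
  b₃ = lookup b (suc (suc zero))

ind-∧ : ∀ x y → ind (x ∧ y) ≡ ind x ℕ.* ind y
ind-∧ false y     = refl
ind-∧ true  false = refl
ind-∧ true  true  = refl

ind-∧-≤ʳ : ∀ x y → ind (x ∧ y) ℕ.≤ ind y
ind-∧-≤ʳ false y = ℕ.z≤n
ind-∧-≤ʳ true  y = ℕₚ.≤-refl

module _ {n : ℕ} where

  private
    V = allVecs n

  additiveQuads-rotate : ∀ (A₁ A₂ A₃ A₄ : Subset n) → additiveQuads A₁ A₂ A₃ A₄ ≡ additiveQuads A₂ A₃ A₄ A₁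
  additiveQuads-rotate A₁ A₂ A₃ A₄ = begin
    sumL V (λ a₁ → sumL V λ a₂ → sumL V λ a₃ → sumL V λ a₄ → F a₁ a₂ a₃ a₄)
      ≡⟨ sumL-comm V V _ ⟩
    sumL V (λ a₂ → sumL V λ a₁ → sumL V λ a₃ → sumL V λ a₄ → F a₁ a₂ a₃ a₄)
      ≡⟨ sumL-cong V (λ a₂ → sumL-comm V V _) ⟩
    sumL V (λ a₂ → sumL V λ a₃ → sumL V λ a₁ → sumL V λ a₄ → F a₁ a₂ a₃ a₄)
      ≡⟨ sumL-cong V (λ a₂ → sumL-cong V λ a₃ → sumL-comm V V _) ⟩
    sumL V (λ a₂ → sumL V λ a₃ → sumL V λ a₄ → sumL V λ a₁ → F a₁ a₂ a₃ a₄)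
      ≡⟨ sumL-cong V (λ a₂ → sumL-cong V λ a₃ → sumL-cong V λ a₄ → sumL-cong V λ a₁ →
           cong ind (rotate a₁ a₂ a₃ a₄)) ⟩
    additiveQuads A₂ A₃ A₄ A₁ ∎
    where
    open ≡-Reasoning
    F : F₂^ n → F₂^ n → F₂^ n → F₂^ n → ℕ
    F a₁ a₂ a₃ a₄ = ind (A₁ a₁ ∧ A₂ a₂ ∧ A₃ a₃ ∧ A₄ a₄ ∧ isZero (a₁ ⊕ a₂ ⊕ a₃ ⊕ a₄))
    ∧-rotate : ∀ a b c d z → a ∧ b ∧ c ∧ d ∧ z ≡ b ∧ c ∧ d ∧ a ∧ z
    ∧-rotate = solve-∀ 𝔹-ring
    ⊕-rotate : ∀ (a₁ a₂ a₃ a₄ : F₂^ n) → a₁ ⊕ a₂ ⊕ a₃ ⊕ a₄ ≡ a₂ ⊕ a₃ ⊕ a₄ ⊕ a₁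
    ⊕-rotate a₁ a₂ a₃ a₄ = begin
      a₁ ⊕ a₂ ⊕ a₃ ⊕ a₄     ≡⟨ cong (_⊕ a₄) (⊕-assoc a₁ a₂ a₃) ⟩
      a₁ ⊕ (a₂ ⊕ a₃) ⊕ a₄   ≡⟨ ⊕-assoc a₁ (a₂ ⊕ a₃) a₄ ⟩
      a₁ ⊕ (a₂ ⊕ a₃ ⊕ a₄)   ≡⟨ ⊕-comm a₁ (a₂ ⊕ a₃ ⊕ a₄) ⟩
      a₂ ⊕ a₃ ⊕ a₄ ⊕ a₁     ∎
    rotate : ∀ a₁ a₂ a₃ a₄ → A₁ a₁ ∧ A₂ a₂ ∧ A₃ a₃ ∧ A₄ a₄ ∧ isZero (a₁ ⊕ a₂ ⊕ a₃ ⊕ a₄)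
                           ≡ A₂ a₂ ∧ A₃ a₃ ∧ A₄ a₄ ∧ A₁ a₁ ∧ isZero (a₂ ⊕ a₃ ⊕ a₄ ⊕ a₁)
    rotate a₁ a₂ a₃ a₄ = trans (∧-rotate (A₁ a₁) (A₂ a₂) (A₃ a₃) (A₄ a₄) _)
      (cong (λ v → A₂ a₂ ∧ A₃ a₃ ∧ A₄ a₄ ∧ A₁ a₁ ∧ isZero v) (⊕-rotate a₁ a₂ a₃ a₄))

  -- a₄ is determined by a₁, a₂, a₃
  additiveQuads-≤-card³ : ∀ (A₁ A₂ A₃ A₄ : Subset n) →
                          additiveQuads A₁ A₂ A₃ A₄ ℕ.≤ card A₁ ℕ.* card A₂ ℕ.* card A₃
  additiveQuads-≤-card³ A₁ A₂ A₃ A₄ = begin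
    additiveQuads A₁ A₂ A₃ A₄
      ≡⟨ sumL-cong V (λ a₁ → sumL-cong V λ a₂ → sumL-cong V λ a₃ → sumL-cong V λ a₄ →
           cong ind (∧-assoc₃ (A₁ a₁) (A₂ a₂) (A₃ a₃) _)) ⟩
    sumL V (λ a₁ → sumL V λ a₂ → sumL V λ a₃ → sumL V λ a₄ →
      ind ((A₁ a₁ ∧ A₂ a₂ ∧ A₃ a₃) ∧ A₄ a₄ ∧ isZero (a₁ ⊕ a₂ ⊕ a₃ ⊕ a₄)))
      ≤⟨ sumL-mono V (λ a₁ → sumL-mono V λ a₂ → sumL-mono V λ a₃ →
           at-most-one (A₁ a₁ ∧ A₂ a₂ ∧ A₃ a₃) (a₁ ⊕ a₂ ⊕ a₃)) ⟩
    sumL V (λ a₁ → sumL V λ a₂ → sumL V λ a₃ → ind (A₁ a₁ ∧ A₂ a₂ ∧ A₃ a₃))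
      ≡⟨ sumL-cong V (λ a₁ → sumL-cong V λ a₂ → sumL-cong V λ a₃ →
           trans (ind-∧ (A₁ a₁) _) (cong (ind (A₁ a₁) ℕ.*_) (ind-∧ (A₂ a₂) (A₃ a₃)))) ⟩
    sumL V (λ a₁ → sumL V λ a₂ → sumL V λ a₃ → ind (A₁ a₁) ℕ.* (ind (A₂ a₂) ℕ.* ind (A₃ a₃)))
      ≡⟨ sumL-cong V (λ a₁ → trans (sumL-cong V λ a₂ → sumL-*ˡ V (ind (A₁ a₁)) _) (sumL-*ˡ V (ind (A₁ a₁)) _)) ⟩
    sumL V (λ a₁ → ind (A₁ a₁) ℕ.* sumL V (λ a₂ → sumL V λ a₃ → ind (A₂ a₂) ℕ.* ind (A₃ a₃)))
      ≡⟨ sumL-cong V (λ a₁ → cong (ind (A₁ a₁) ℕ.*_) (sumL-product V V (ind ∘ A₂) (ind ∘ A₃))) ⟩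
    sumL V (λ a₁ → ind (A₁ a₁) ℕ.* (sumL V (ind ∘ A₂) ℕ.* sumL V (ind ∘ A₃)))
      ≡⟨ sumL-*ʳ V (ind ∘ A₁) _ ⟩
    sumL V (ind ∘ A₁) ℕ.* (sumL V (ind ∘ A₂) ℕ.* sumL V (ind ∘ A₃))
      ≡⟨ sym (ℕₚ.*-assoc (sumL V (ind ∘ A₁)) _ _) ⟩
    sumL V (ind ∘ A₁) ℕ.* sumL V (ind ∘ A₂) ℕ.* sumL V (ind ∘ A₃)
      ≡⟨ sym (cong₂ ℕ._*_ (cong₂ ℕ._*_ (card-sum A₁) (card-sum A₂)) (card-sum A₃)) ⟩
    card A₁ ℕ.* card A₂ ℕ.* card A₃ ∎
    where
    open ℕₚ.≤-Reasoning
    ∧-assoc₃ : ∀ a b c r → a ∧ b ∧ c ∧ r ≡ (a ∧ b ∧ c) ∧ r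
    ∧-assoc₃ = solve-∀ 𝔹-ring
    at-most-one : ∀ c w → sumL V (λ a₄ → ind (c ∧ A₄ a₄ ∧ isZero (w ⊕ a₄))) ℕ.≤ ind c
    at-most-one false w = ℕₚ.≤-reflexive (sumL-zero V)
    at-most-one true  w = ℕₚ.≤-trans (sumL-mono V (λ a₄ → ind-∧-≤ʳ (A₄ a₄) _)) (ℕₚ.≤-reflexive (sumL-isZero w))

  additiveQuads⁴≤cards³ : ∀ (A₁ A₂ A₃ A₄ : Subset n) →
    additiveQuads A₁ A₂ A₃ A₄ ℕ.^ 4 ℕ.≤ (card A₁ ℕ.* card A₂ ℕ.* card A₃ ℕ.* card A₄) ℕ.^ 3
  additiveQuads⁴≤cards³ A₁ A₂ A₃ A₄ = begin
    Q ℕ.* (Q ℕ.* (Q ℕ.* (Q ℕ.* 1)))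
      ≤⟨ ℕₚ.*-mono-≤ (additiveQuads-≤-card³ A₁ A₂ A₃ A₄)
        (ℕₚ.*-mono-≤ (subst (ℕ._≤ _) (sym rotate¹) (additiveQuads-≤-card³ A₂ A₃ A₄ A₁))
        (ℕₚ.*-mono-≤ (subst (ℕ._≤ _) (sym rotate²) (additiveQuads-≤-card³ A₃ A₄ A₁ A₂))
        (ℕₚ.*-mono-≤ (subst (ℕ._≤ _) (sym rotate³) (additiveQuads-≤-card³ A₄ A₁ A₂ A₃)) ℕₚ.≤-refl))) ⟩
    c₁ ℕ.* c₂ ℕ.* c₃ ℕ.* (c₂ ℕ.* c₃ ℕ.* c₄ ℕ.* (c₃ ℕ.* c₄ ℕ.* c₁ ℕ.* (c₄ ℕ.* c₁ ℕ.* c₂ ℕ.* 1)))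
      ≡⟨ regroup c₁ c₂ c₃ c₄ ⟩
    (c₁ ℕ.* c₂ ℕ.* c₃ ℕ.* c₄) ℕ.^ 3 ∎
    where
    open ℕₚ.≤-Reasoning
    Q = additiveQuads A₁ A₂ A₃ A₄
    c₁ = card A₁
    c₂ = card A₂
    c₃ = card A₃
    c₄ = card A₄
    rotate¹ : Q ≡ additiveQuads A₂ A₃ A₄ A₁
    rotate¹ = additiveQuads-rotate A₁ A₂ A₃ A₄
    rotate² : Q ≡ additiveQuads A₃ A₄ A₁ A₂
    rotate² = trans rotate¹ (additiveQuads-rotate A₂ A₃ A₄ A₁)
    rotate³ : Q ≡ additiveQuads A₄ A₁ A₂ A₃
    rotate³ = trans rotate² (additiveQuads-rotate A₃ A₄ A₁ A₂)
    regroup : ∀ a b c d → a ℕ.* b ℕ.* c ℕ.* (b ℕ.* c ℕ.* d ℕ.* (c ℕ.* d ℕ.* a ℕ.* (d ℕ.* a ℕ.* b ℕ.* 1)))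
                        ≡ a ℕ.* b ℕ.* c ℕ.* d ℕ.* (a ℕ.* b ℕ.* c ℕ.* d ℕ.* (a ℕ.* b ℕ.* c ℕ.* d ℕ.* 1))
    regroup = ℕ-Solver.solve-∀

quadCount : ∀ {n} → Quad (Subset n) → ℕ
quadCount A = additiveQuads (A ! i₁) (A ! i₂) (A ! i₃) (A ! i₄)

cardProduct : ∀ {n} → Quad (Subset n) → ℕ
cardProduct A = card (A ! i₁) ℕ.* card (A ! i₂) ℕ.* card (A ! i₃) ℕ.* card (A ! i₄)

slices : ∀ {n} → Quad (Subset n) → F₂^ n → F₂^ 3 → Quad (Subset n)
slices A ξ b =
  ⟨ slice (A ! i₁) ξ (e ! i₁) , slice (A ! i₂) ξ (e ! i₂) , slice (A ! i₃) ξ (e ! i₃) , slice (A ! i₄) ξ (e ! i₄) ⟩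
  where e = evenExtension b

private
  matches : Bool → Bool → Bool → Bool → F₂^ 3 → Bool
  matches c₁ c₂ c₃ c₄ b = agree c₁ (e ! i₁) ∧ agree c₂ (e ! i₂) ∧ agree c₃ (e ! i₃) ∧ agree c₄ (e ! i₄)
    where e = evenExtension b

  unique-match : ∀ c₁ c₂ c₃ → sumL (allVecs 3) (ind ∘ matches c₁ c₂ c₃ (c₁ xor c₂ xor c₃)) ≡ 1
  unique-match false false false = refl
  unique-match false false true  = refl
  unique-match false true  false = refl
  unique-match false true  true  = refl
  unique-match true  false false = refl
  unique-match true  false true  = refl
  unique-match true  true  false = refl
  unique-match true  true  true  = refl

  sumL-matches : ∀ r c₁ c₂ c₃ c₄ → (r ≡ true → c₄ ≡ c₁ xor c₂ xor c₃) →
                 sumL (allVecs 3) (λ b → ind (r ∧ matches c₁ c₂ c₃ c₄ b)) ≡ ind r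
  sumL-matches false c₁ c₂ c₃ c₄ forced = refl
  sumL-matches true  c₁ c₂ c₃ c₄ forced rewrite forced refl = unique-match c₁ c₂ c₃

  ∧-true-right : ∀ x y → x ∧ y ≡ true → y ≡ true
  ∧-true-right true y x∧y≡true = x∧y≡true

quadCount-slices : ∀ {n} (A : Quad (Subset n)) ξ → quadCount A ≡ sumL (allVecs 3) (quadCount ∘ slices A ξ)
quadCount-slices {n} A ξ = begin
  sumL V (λ a₁ → sumL V λ a₂ → sumL V λ a₃ → sumL V λ a₄ → F a₁ a₂ a₃ a₄)
    ≡⟨ sumL-cong V (λ a₁ → sumL-cong V λ a₂ → sumL-cong V λ a₃ → sumL-cong V λ a₄ →
         split-summand a₁ a₂ a₃ a₄) ⟩
  sumL V (λ a₁ → sumL V λ a₂ → sumL V λ a₃ → sumL V λ a₄ → sumL B λ b → G b a₁ a₂ a₃ a₄)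
    ≡⟨ sumL-cong V (λ a₁ → sumL-cong V λ a₂ → sumL-cong V λ a₃ → sumL-comm V B λ a₄ b → G b a₁ a₂ a₃ a₄) ⟩
  sumL V (λ a₁ → sumL V λ a₂ → sumL V λ a₃ → sumL B λ b → sumL V λ a₄ → G b a₁ a₂ a₃ a₄)
    ≡⟨ sumL-cong V (λ a₁ → sumL-cong V λ a₂ → sumL-comm V B λ a₃ b → sumL V λ a₄ → G b a₁ a₂ a₃ a₄) ⟩
  sumL V (λ a₁ → sumL V λ a₂ → sumL B λ b → sumL V λ a₃ → sumL V λ a₄ → G b a₁ a₂ a₃ a₄)
    ≡⟨ sumL-cong V (λ a₁ → sumL-comm V B λ a₂ b → sumL V λ a₃ → sumL V λ a₄ → G b a₁ a₂ a₃ a₄) ⟩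
  sumL V (λ a₁ → sumL B λ b → sumL V λ a₂ → sumL V λ a₃ → sumL V λ a₄ → G b a₁ a₂ a₃ a₄)
    ≡⟨ sumL-comm V B (λ a₁ b → sumL V λ a₂ → sumL V λ a₃ → sumL V λ a₄ → G b a₁ a₂ a₃ a₄) ⟩
  sumL B (λ b → sumL V λ a₁ → sumL V λ a₂ → sumL V λ a₃ → sumL V λ a₄ → G b a₁ a₂ a₃ a₄) ∎
  where
  open ≡-Reasoning
  V = allVecs n
  B = allVecs 3
  F : F₂^ n → F₂^ n → F₂^ n → F₂^ n → ℕ
  F a₁ a₂ a₃ a₄ = ind ((A ! i₁) a₁ ∧ (A ! i₂) a₂ ∧ (A ! i₃) a₃ ∧ (A ! i₄) a₄ ∧ isZero (a₁ ⊕ a₂ ⊕ a₃ ⊕ a₄))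
  G : F₂^ 3 → F₂^ n → F₂^ n → F₂^ n → F₂^ n → ℕ
  G b a₁ a₂ a₃ a₄ = ind ((S ! i₁) a₁ ∧ (S ! i₂) a₂ ∧ (S ! i₃) a₃ ∧ (S ! i₄) a₄ ∧ isZero (a₁ ⊕ a₂ ⊕ a₃ ⊕ a₄))
    where S = slices A ξ b
  shuffle : ∀ α₁ s₁ α₂ s₂ α₃ s₃ α₄ s₄ z → (α₁ ∧ s₁) ∧ (α₂ ∧ s₂) ∧ (α₃ ∧ s₃) ∧ (α₄ ∧ s₄) ∧ z
                                          ≡ (α₁ ∧ α₂ ∧ α₃ ∧ α₄ ∧ z) ∧ (s₁ ∧ s₂ ∧ s₃ ∧ s₄)
  shuffle = solve-∀ 𝔹-ring
  split-summand : ∀ a₁ a₂ a₃ a₄ → F a₁ a₂ a₃ a₄ ≡ sumL B (λ b → G b a₁ a₂ a₃ a₄)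
  split-summand a₁ a₂ a₃ a₄ = sym (trans
    (sumL-cong B λ b → let e = evenExtension b in cong ind (shuffle
      ((A ! i₁) a₁) (agree c₁ (e ! i₁)) ((A ! i₂) a₂) (agree c₂ (e ! i₂))
      ((A ! i₃) a₃) (agree c₃ (e ! i₃)) ((A ! i₄) a₄) (agree c₄ (e ! i₄)) z))
    (sumL-matches _ c₁ c₂ c₃ c₄ forced))
    where
    c₁ = ξ · a₁
    c₂ = ξ · a₂
    c₃ = ξ · a₃
    c₄ = ξ · a₄
    z = isZero (a₁ ⊕ a₂ ⊕ a₃ ⊕ a₄)
    forced : (A ! i₁) a₁ ∧ (A ! i₂) a₂ ∧ (A ! i₃) a₃ ∧ (A ! i₄) a₄ ∧ z ≡ true → c₄ ≡ c₁ xor c₂ xor c₃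
    forced all≡true = begin
      ξ · a₄                              ≡⟨ cong (ξ ·_) (sym (isZero-⊕ (a₁ ⊕ a₂ ⊕ a₃) a₄ z≡true)) ⟩
      ξ · (a₁ ⊕ a₂ ⊕ a₃)                  ≡⟨ ·-⊕ ξ (a₁ ⊕ a₂) a₃ ⟩
      ξ · (a₁ ⊕ a₂) xor c₃                ≡⟨ cong (_xor c₃) (·-⊕ ξ a₁ a₂) ⟩
      (c₁ xor c₂) xor c₃                  ≡⟨ xor-assoc c₁ c₂ c₃ ⟩
      c₁ xor c₂ xor c₃                    ∎
      where
      z≡true : z ≡ true
      z≡true = ∧-true-right ((A ! i₄) a₄) z (∧-true-right ((A ! i₃) a₃) _
                 (∧-true-right ((A ! i₂) a₂) _ (∧-true-right ((A ! i₁) a₁) _ all≡true)))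

share : ℚ → Bool → ℚ
share p false = p
share p true  = 1ℚ - p

bias : ℚ → ℚ
bias p = p - (1ℚ - p)

share-≤1 : ∀ x c → 0ℚ ≤ share x (not c) → share x c ≤ 1ℚ
share-≤1 x false 0≤1-x = ≤-by-difference _ refl 0≤1-x
share-≤1 x true  0≤x   = ≤-by-difference _ (complement x) 0≤x
  where
  complement : ∀ x → 1ℚ - (1ℚ - x) ≡ x
  complement = solve-∀ ℚ-ring

bias²≤1 : ∀ {p} → 0ℚ ≤ p → 0ℚ ≤ 1ℚ - p → bias p * bias p ≤ 1ℚ
bias²≤1 {p} 0≤p 0≤1-p = ≤-by-difference _ (certificate p) (*-nonNeg (*-nonNeg (nonNegative⁻¹ (+ 4 / 1)) 0≤p) 0≤1-p)
  where
  certificate : ∀ p → let f = p - (1ℚ - p) in 1ℚ - f * f ≡ + 4 / 1 * p * (1ℚ - p)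
  certificate = solve-∀ ℚ-ring

-- recip 0 = 0, so density is only meaningful for non-empty A.
density : ∀ {n} → Subset n → F₂^ n → ℚ
density A ξ = ℕ→ℚ (card (slice A ξ false)) * recip (ℕ→ℚ (card A))

*-recip : ∀ q → 0ℚ < q → q * recip q ≡ 1ℚ
*-recip q 0<q with q ≟ 0ℚ
... | yes q≡0 = ⊥-elim (<-irrefl (sym q≡0) 0<q)
... | no  q≢0 = *-inverseʳ q {{≢-nonZero q≢0}}

module _ {n : ℕ} (A : Subset n) (ξ : F₂^ n) (A≢∅ : NonEmpty A) where

  private
    S S₀ S₁ p : ℚ
    S  = ℕ→ℚ (card A)
    S₀ = ℕ→ℚ (card (slice A ξ false))
    S₁ = ℕ→ℚ (card (slice A ξ true))
    p  = density A ξ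

    0<S : 0ℚ < S
    0<S = card-pos A A≢∅

    S*p≡S₀ : S * p ≡ S₀
    S*p≡S₀ = begin
      S * (S₀ * recip S)  ≡⟨ swap S S₀ (recip S) ⟩
      S₀ * (S * recip S)  ≡⟨ cong (S₀ *_) (*-recip S 0<S) ⟩
      S₀ * 1ℚ             ≡⟨ *-identityʳ S₀ ⟩
      S₀                  ∎
      where
      open ≡-Reasoning
      swap : ∀ a b c → a * (b * c) ≡ b * (a * c)
      swap = solve-∀ ℚ-ring

    S₀+S₁≡S : S₀ + S₁ ≡ S
    S₀+S₁≡S = trans (sym (ℕ→ℚ-+ (card (slice A ξ false)) (card (slice A ξ true)))) (cong ℕ→ℚ (sym (card-slices A ξ)))

  card-slice : ∀ b → ℕ→ℚ (card (slice A ξ b)) ≡ S * share p b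
  card-slice false = sym S*p≡S₀
  card-slice true  = begin
    S₁                ≡⟨ complement S₀ S₁ ⟩
    (S₀ + S₁) - S₀    ≡⟨ cong₂ _-_ S₀+S₁≡S (sym S*p≡S₀) ⟩
    S - S * p         ≡⟨ factor S p ⟩
    S * (1ℚ - p)      ∎
    where
    open ≡-Reasoning
    complement : ∀ a b → b ≡ (a + b) - a
    complement = solve-∀ ℚ-ring
    factor : ∀ s p → s - s * p ≡ s * (1ℚ - p)
    factor = solve-∀ ℚ-ring

  share-nonNeg : ∀ b → 0ℚ ≤ share p b
  share-nonNeg b = *-cancelˡ-≤-pos S {{positive 0<S}}
    (subst₂ _≤_ (sym (*-zeroʳ S)) (card-slice b) (ℕ→ℚ-nonNeg (card (slice A ξ b))))

  private
    u : ℚ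
    u = 2⁻ⁿ n

    0<Su : 0ℚ < S * u
    0<Su = *-pos 0<S (positive⁻¹ u {{normalize-pos 1 (2 ℕ.^ n) {{ℕ.>-nonZero (ℕₚ.m^n>0 2 n)}}}})

    fourier² : fourier A ξ ^ℚ 2 ≡ bias p * bias p * (S * u) ^ℚ 2
    fourier² = begin
      fourier A ξ ^ℚ 2                       ≡⟨ cong (_^ℚ 2) (fourier-slices A ξ) ⟩
      ((S₀ - S₁) * u) ^ℚ 2                   ≡⟨ cong (λ x → ((x - S₁) * u) ^ℚ 2) (sym S*p≡S₀) ⟩
      ((S * p - S₁) * u) ^ℚ 2                ≡⟨ cong (λ x → ((S * p - x) * u) ^ℚ 2) (card-slice true) ⟩
      ((S * p - S * (1ℚ - p)) * u) ^ℚ 2      ≡⟨ regroup S p u ⟩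
      bias p * bias p * (S * u) ^ℚ 2         ∎
      where
      open ≡-Reasoning
      regroup : ∀ s p u → let x = (s * p - s * (1ℚ - p)) * u ; f = p - (1ℚ - p) ; y = s * u in
                x * (x * 1ℚ) ≡ f * f * (y * (y * 1ℚ))
      regroup = solve-∀ ℚ-ring

  InSpec⇒≤bias² : ∀ {α²} → InSpec α² A ξ → α² ≤ bias p * bias p
  InSpec⇒≤bias² α²∈ = *-cancelʳ-≤-pos ((S * u) ^ℚ 2) {{positive (^-pos 2 0<Su)}} (subst (_ ≤_) fourier² α²∈)

  ≤bias²⇒InSpec : ∀ {α²} → α² ≤ bias p * bias p → InSpec α² A ξ
  ≤bias²⇒InSpec α²≤ = subst (_ ≤_) (sym fourier²) (*-monoʳ-≤′ (^-nonNeg 2 (<⇒≤ 0<Su)) α²≤)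

-- AM–GM with a gap

≤-mean² : ∀ x y → x * y ≤ ((x + y) * (+ 1 / 2)) * ((x + y) * (+ 1 / 2))
≤-mean² x y = ≤-by-difference _ (identity x y) (square-nonNeg ((x - y) * (+ 1 / 2)))
  where
  identity : ∀ x y → ((x + y) * (+ 1 / 2)) * ((x + y) * (+ 1 / 2)) - x * y ≡ ((x - y) * (+ 1 / 2)) * ((x - y) * (+ 1 / 2))
  identity = solve-∀ ℚ-ring

-- The AM–GM bound for (abcd)^{3/4} by the mean of the triple products, lowered
-- by a gap that is affordable as soon as a, b ∈ [0, 1].
amgmBound : ℚ → ℚ → ℚ → ℚ → ℚ
amgmBound a b c d = (b * c * d + a * c * d + a * b * d + a * b * c) * (+ 1 / 4) - c * d * ((a - b) * (a - b)) * (+ 1 / 16)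

private
  lowerHalf² : ∀ a b c d →
    let U = (b * c * d + a * c * d) * (+ 1 / 2) - c * d * ((a - b) * (a - b)) * (+ 1 / 8)
        e = c * d * ((a - b) * (a - b)) * (+ 1 / 8)
    in U * U - (b * c * d) * (a * c * d) ≡ c * c * d * d * ((a - b) * (a - b)) * ((1ℚ - a) + (1ℚ - b)) * (+ 1 / 8) + e * e
  lowerHalf² = solve-∀ ℚ-ring

  lowerHalf-expand : ∀ a b c d →
    (b * c * d + a * c * d) * (+ 1 / 2) - c * d * ((a - b) * (a - b)) * (+ 1 / 8)
      ≡ c * d * (a * (+ 3 / 1 + (1ℚ - a)) + b * (+ 3 / 1 + (1ℚ - b)) + + 2 / 1 * a * b) * (+ 1 / 8)
  lowerHalf-expand = solve-∀ ℚ-ring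

  halves-mean : ∀ a b c d →
    let U = (b * c * d + a * c * d) * (+ 1 / 2) - c * d * ((a - b) * (a - b)) * (+ 1 / 8)
        M = (a * b * d + a * b * c) * (+ 1 / 2)
    in (U + M) * (+ 1 / 2) ≡ (b * c * d + a * c * d + a * b * d + a * b * c) * (+ 1 / 4) - c * d * ((a - b) * (a - b)) * (+ 1 / 16)
  halves-mean = solve-∀ ℚ-ring

module _ {a b c d : ℚ} (0≤a : 0ℚ ≤ a) (a≤1 : a ≤ 1ℚ) (0≤b : 0ℚ ≤ b) (b≤1 : b ≤ 1ℚ)
         (0≤c : 0ℚ ≤ c) (0≤d : 0ℚ ≤ d) where

  private
    U = (b * c * d + a * c * d) * (+ 1 / 2) - c * d * ((a - b) * (a - b)) * (+ 1 / 8)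
    M = (a * b * d + a * b * c) * (+ 1 / 2)

    0≤1-x : ∀ {x} → x ≤ 1ℚ → 0ℚ ≤ 1ℚ - x
    0≤1-x = ≤⇒0≤-

    0≤U : 0ℚ ≤ U
    0≤U = subst (0ℚ ≤_) (sym (lowerHalf-expand a b c d))
      (*-nonNeg (*-nonNeg (*-nonNeg 0≤c 0≤d)
        (+-mono-≤ (+-mono-≤ (*-nonNeg 0≤a (+-mono-≤ (nonNegative⁻¹ (+ 3 / 1)) (0≤1-x a≤1)))
                            (*-nonNeg 0≤b (+-mono-≤ (nonNegative⁻¹ (+ 3 / 1)) (0≤1-x b≤1))))
                  (*-nonNeg (*-nonNeg (nonNegative⁻¹ (+ 2 / 1)) 0≤a) 0≤b)))
        (≤ᵇ⇒≤ tt))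

    0≤M : 0ℚ ≤ M
    0≤M = *-nonNeg (+-mono-≤ (*-nonNeg (*-nonNeg 0≤a 0≤b) 0≤d) (*-nonNeg (*-nonNeg 0≤a 0≤b) 0≤c)) (≤ᵇ⇒≤ tt)

    first-pair : (b * c * d) * (a * c * d) ≤ U * U
    first-pair = ≤-by-difference _ (lowerHalf² a b c d)
      (+-mono-≤ (*-nonNeg (*-nonNeg c²d²[a-b]² slack) (≤ᵇ⇒≤ tt)) (square-nonNeg (c * d * ((a - b) * (a - b)) * (+ 1 / 8))))
      where
      c²d²[a-b]² : 0ℚ ≤ c * c * d * d * ((a - b) * (a - b))
      c²d²[a-b]² = *-nonNeg (*-nonNeg (*-nonNeg (*-nonNeg 0≤c 0≤c) 0≤d) 0≤d) (square-nonNeg (a - b))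
      slack : 0ℚ ≤ (1ℚ - a) + (1ℚ - b)
      slack = +-mono-≤ (0≤1-x a≤1) (0≤1-x b≤1)

  amgmBound-nonNeg : 0ℚ ≤ amgmBound a b c d
  amgmBound-nonNeg = subst (0ℚ ≤_) (halves-mean a b c d) (*-nonNeg (+-mono-≤ 0≤U 0≤M) (≤ᵇ⇒≤ tt))

  am-gm-gap : (a * b * c * d) ^ℚ 3 ≤ amgmBound a b c d ^ℚ 4
  am-gm-gap = begin
    (a * b * c * d) ^ℚ 3                          ≡⟨ triples a b c d ⟩
    (b * c * d) * (a * c * d) * ((a * b * d) * (a * b * c))
      ≤⟨ *-mono-≤-nonNeg (*-nonNeg (*-nonNeg (*-nonNeg 0≤b 0≤c) 0≤d) (*-nonNeg (*-nonNeg 0≤a 0≤c) 0≤d)) first-pair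
                         (*-nonNeg (*-nonNeg (*-nonNeg 0≤a 0≤b) 0≤d) (*-nonNeg (*-nonNeg 0≤a 0≤b) 0≤c))
                         (≤-mean² (a * b * d) (a * b * c)) ⟩
    U * U * (M * M)                               ≡⟨ interchange U M ⟩
    U * M * (U * M)                               ≤⟨ *-mono-≤-nonNeg 0≤UM (≤-mean² U M) 0≤UM (≤-mean² U M) ⟩
    Z * Z * (Z * Z)                               ≡⟨ fourth Z ⟩
    Z ^ℚ 4                                        ≡⟨ cong (_^ℚ 4) (halves-mean a b c d) ⟩
    amgmBound a b c d ^ℚ 4                        ∎
    where
    open ≤-Reasoning
    Z : ℚ
    Z = (U + M) * (+ 1 / 2)
    0≤UM : 0ℚ ≤ U * M
    0≤UM = *-nonNeg 0≤U 0≤M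
    triples : ∀ a b c d → let x = a * b * c * d in x * (x * (x * 1ℚ)) ≡ (b * c * d) * (a * c * d) * ((a * b * d) * (a * b * c))
    triples = solve-∀ ℚ-ring
    interchange : ∀ x y → x * x * (y * y) ≡ x * y * (x * y)
    interchange = solve-∀ ℚ-ring
    fourth : ∀ z → z * z * (z * z) ≡ z * (z * (z * (z * 1ℚ)))
    fourth = solve-∀ ℚ-ring

-- Splitting the four indices into two pairs

data Pair : Set where
  π₁₂ π₁₃ π₁₄ π₂₃ π₂₄ π₃₄ : Pair

fst snd fstᶜ sndᶜ : Pair → Idx
fst π₁₂ = i₁
fst π₁₃ = i₁
fst π₁₄ = i₁
fst π₂₃ = i₂
fst π₂₄ = i₂
fst π₃₄ = i₃
snd π₁₂ = i₂
snd π₁₃ = i₃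
snd π₁₄ = i₄
snd π₂₃ = i₃
snd π₂₄ = i₄
snd π₃₄ = i₄
fstᶜ π₁₂ = i₃
fstᶜ π₁₃ = i₂
fstᶜ π₁₄ = i₂
fstᶜ π₂₃ = i₁
fstᶜ π₂₄ = i₁
fstᶜ π₃₄ = i₁
sndᶜ π₁₂ = i₄
sndᶜ π₁₃ = i₄
sndᶜ π₁₄ = i₃
sndᶜ π₂₃ = i₄
sndᶜ π₂₄ = i₃
sndᶜ π₃₄ = i₂

separate : ∀ i j → i ≢ j → Σ Pair λ π → (i ≡ fst π ⊎ i ≡ snd π) × (j ≡ fstᶜ π ⊎ j ≡ sndᶜ π)
separate i₁ i₂ _ = π₁₃ , inj₁ refl , inj₁ refl
separate i₁ i₃ _ = π₁₂ , inj₁ refl , inj₁ refl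
separate i₁ i₄ _ = π₁₂ , inj₁ refl , inj₂ refl
separate i₂ i₁ _ = π₂₃ , inj₁ refl , inj₁ refl
separate i₂ i₃ _ = π₁₂ , inj₂ refl , inj₁ refl
separate i₂ i₄ _ = π₁₂ , inj₂ refl , inj₂ refl
separate i₃ i₁ _ = π₃₄ , inj₁ refl , inj₁ refl
separate i₃ i₂ _ = π₃₄ , inj₁ refl , inj₂ refl
separate i₃ i₄ _ = π₁₃ , inj₂ refl , inj₂ refl
separate i₄ i₁ _ = π₂₄ , inj₂ refl , inj₁ refl
separate i₄ i₂ _ = π₁₄ , inj₂ refl , inj₁ refl
separate i₄ i₃ _ = π₁₄ , inj₂ refl , inj₂ refl
separate i₁ i₁ i≢i = ⊥-elim (i≢i refl)
separate i₂ i₂ i≢i = ⊥-elim (i≢i refl)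
separate i₃ i₃ i≢i = ⊥-elim (i≢i refl)
separate i₄ i₄ i≢i = ⊥-elim (i≢i refl)

neighbour : Idx → Idx
neighbour i₁ = i₂
neighbour i₂ = i₁
neighbour i₃ = i₁
neighbour i₄ = i₁

neighbour-≢ : ∀ i → i ≢ neighbour i
neighbour-≢ i₁ ()
neighbour-≢ i₂ ()
neighbour-≢ i₃ ()
neighbour-≢ i₄ ()

Covers : (Idx → ℚ) → Idx → Pair → Set
Covers f i π = f i * f i ≤ f (fst π) * f (fst π) + f (snd π) * f (snd π)

Balanced : (Idx → ℚ) → Pair → Set
Balanced f π = (f (fstᶜ π) * f (sndᶜ π)) * (f (fstᶜ π) * f (sndᶜ π)) ≤ + 81 / 100

module _ (f : Idx → ℚ) (f²≤1 : ∀ i → f i * f i ≤ 1ℚ) where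

  private
    from-separation : ∀ {i j} → f j * f j ≤ + 81 / 100 →
                      Σ Pair (λ π → (i ≡ fst π ⊎ i ≡ snd π) × (j ≡ fstᶜ π ⊎ j ≡ sndᶜ π)) →
                      Σ Pair λ π → Covers f i π × Balanced f π
    from-separation small (π , i∈π , j∈πᶜ) = π , covers i∈π , balanced j∈πᶜ small
      where
      x = f (fst π)
      y = f (snd π)
      covers : ∀ {i} → i ≡ fst π ⊎ i ≡ snd π → Covers f i π
      covers (inj₁ refl) = subst (_≤ x * x + y * y) (+-identityʳ (x * x)) (+-monoʳ-≤ (x * x) (square-nonNeg y))
      covers (inj₂ refl) = subst (_≤ x * x + y * y) (+-identityˡ (y * y)) (+-monoˡ-≤ (y * y) (square-nonNeg x))
      product² : ∀ r s → (r * s) * (r * s) ≡ (r * r) * (s * s)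
      product² = solve-∀ ℚ-ring
      r = f (fstᶜ π)
      s = f (sndᶜ π)
      balanced : ∀ {j} → j ≡ fstᶜ π ⊎ j ≡ sndᶜ π → f j * f j ≤ + 81 / 100 → Balanced f π
      balanced (inj₁ refl) small = subst₂ _≤_ (sym (product² r s)) (*-identityʳ _)
        (*-mono-≤-nonNeg (square-nonNeg r) small (square-nonNeg s) (f²≤1 (sndᶜ π)))
      balanced (inj₂ refl) small = subst₂ _≤_ (sym (product² r s)) (*-identityˡ _)
        (*-mono-≤-nonNeg (square-nonNeg r) (f²≤1 (fstᶜ π)) (square-nonNeg s) small)

  -- When i = j, a neighbour k of i serves: either f k is small and takes the
  -- role of j, or it is large and dominates f i.
  choose-pair : ∀ i j → f j * f j < + 81 / 100 → Σ Pair λ π → Covers f i π × Balanced f π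
  choose-pair i j small with i ≟ᶠ j
  ... | no i≢j = from-separation (<⇒≤ small) (separate i j i≢j)
  ... | yes refl with f (neighbour i) * f (neighbour i) <? + 81 / 100
  ...   | yes k-small = from-separation (<⇒≤ k-small) (separate i (neighbour i) (neighbour-≢ i))
  ...   | no  k-large with from-separation (<⇒≤ small) (separate (neighbour i) i (neighbour-≢ i ∘ sym))
  ...     | π , k-covered , balanced = π , ≤-trans (<⇒≤ (<-≤-trans small (≮⇒≥ k-large))) k-covered , balanced

deficitOf : ℚ → ℚ → ℚ → ℚ
deficitOf x y t = (x * x + y * y - + 2 / 1 * x * y * t) * (+ 1 / 32)

deficitOf-≥ : ∀ x y t → t * t ≤ + 81 / 100 → (x * x + y * y) * (+ 1 / 320) ≤ deficitOf x y t
deficitOf-≥ x y t t²≤ = ≤-by-difference _ (certificate x y t)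
  (*-nonNeg (+-mono-≤ (*-nonNeg (≤⇒0≤- -t≤) (square-nonNeg (x - y))) (*-nonNeg (≤⇒0≤- t≤) (square-nonNeg (x + y))))
            (≤ᵇ⇒≤ tt))
  where
  c = + 9 / 10
  t≤ : t ≤ c
  t≤ = square-≤⇒≤ (≤ᵇ⇒≤ tt) t²≤
  negate² : ∀ t → (- t) * (- t) ≡ t * t
  negate² = solve-∀ ℚ-ring
  -t≤ : - t ≤ c
  -t≤ = square-≤⇒≤ (≤ᵇ⇒≤ tt) (subst (_≤ + 81 / 100) (sym (negate² t)) t²≤)
  certificate : ∀ x y t → (x * x + y * y - + 2 / 1 * x * y * t) * (+ 1 / 32) - (x * x + y * y) * (+ 1 / 320)
              ≡ ((+ 9 / 10 - - t) * ((x - y) * (x - y)) + (+ 9 / 10 - t) * ((x + y) * (x + y))) * (+ 1 / 64)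
  certificate = solve-∀ ℚ-ring

-- The eight pieces

shares : Quad ℚ → F₂^ 3 → Quad ℚ
shares p b = ⟨ share (p ! i₁) (e ! i₁) , share (p ! i₂) (e ! i₂) , share (p ! i₃) (e ! i₃) , share (p ! i₄) (e ! i₄) ⟩
  where e = evenExtension b

product : Quad ℚ → ℚ
product v = v ! i₁ * v ! i₂ * v ! i₃ * v ! i₄

bound : Pair → Quad ℚ → F₂^ 3 → ℚ
bound π p b = amgmBound (v ! fst π) (v ! snd π) (v ! fstᶜ π) (v ! sndᶜ π)
  where v = shares p b

shares-! : ∀ p b i → shares p b ! i ≡ share (p ! i) (evenExtension b ! i)
shares-! p b i₁ = refl
shares-! p b i₂ = refl
shares-! p b i₃ = refl
shares-! p b i₄ = refl

module _ {p : Quad ℚ} (0≤share : ∀ i b → 0ℚ ≤ share (p ! i) b) where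

  shares-nonNeg : ∀ b i → 0ℚ ≤ shares p b ! i
  shares-nonNeg b i = subst (0ℚ ≤_) (sym (shares-! p b i)) (0≤share i (evenExtension b ! i))

  shares-≤1 : ∀ b i → shares p b ! i ≤ 1ℚ
  shares-≤1 b i = subst (_≤ 1ℚ) (sym (shares-! p b i))
    (share-≤1 (p ! i) (evenExtension b ! i) (0≤share i (not (evenExtension b ! i))))

deficit : Pair → Quad ℚ → ℚ
deficit π p = deficitOf (f (fst π)) (f (snd π)) (f (fstᶜ π) * f (sndᶜ π))
  where
  f : Idx → ℚ
  f i = bias (p ! i)

product-pair : ∀ π v → product v ≡ v ! fst π * v ! snd π * v ! fstᶜ π * v ! sndᶜ π
product-pair π₁₂ v = refl
product-pair π₁₃ v = swap₂₃ (v ! i₁) (v ! i₂) (v ! i₃) (v ! i₄)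
  where
  swap₂₃ : ∀ a b c d → a * b * c * d ≡ a * c * b * d
  swap₂₃ = solve-∀ ℚ-ring
product-pair π₁₄ v = cycle (v ! i₁) (v ! i₂) (v ! i₃) (v ! i₄)
  where
  cycle : ∀ a b c d → a * b * c * d ≡ a * d * b * c
  cycle = solve-∀ ℚ-ring
product-pair π₂₃ v = cycle (v ! i₁) (v ! i₂) (v ! i₃) (v ! i₄)
  where
  cycle : ∀ a b c d → a * b * c * d ≡ b * c * a * d
  cycle = solve-∀ ℚ-ring
product-pair π₂₄ v = shuffle (v ! i₁) (v ! i₂) (v ! i₃) (v ! i₄)
  where
  shuffle : ∀ a b c d → a * b * c * d ≡ b * d * a * c
  shuffle = solve-∀ ℚ-ring
product-pair π₃₄ v = swap-pairs (v ! i₁) (v ! i₂) (v ! i₃) (v ! i₄)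
  where
  swap-pairs : ∀ a b c d → a * b * c * d ≡ c * d * a * b
  swap-pairs = solve-∀ ℚ-ring

-- Written with local copies of amgmBound and bias, so that the ring solver
-- sees the polynomial in a, b, c, d.
bound-sum₁₂ : ∀ a b c d → sumQ (allVecs 3) (bound π₁₂ ⟨ a , b , c , d ⟩) ≡ 1ℚ - deficit π₁₂ ⟨ a , b , c , d ⟩
bound-sum₁₂ = identity
  where
  identity : ∀ a b c d →
    let ā = 1ℚ - a ; b̄ = 1ℚ - b ; c̄ = 1ℚ - c ; d̄ = 1ℚ - d
        m : ℚ → ℚ → ℚ → ℚ → ℚ
        m x y z w = (y * z * w + x * z * w + x * y * w + x * y * z) * (+ 1 / 4) - z * w * ((x - y) * (x - y)) * (+ 1 / 16)
        f : ℚ → ℚ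
        f x = x - (1ℚ - x)
    in m a b c d + (m a b c̄ d̄ + (m a b̄ c d̄ + (m a b̄ c̄ d +
       (m ā b c d̄ + (m ā b c̄ d + (m ā b̄ c d + (m ā b̄ c̄ d̄ + 0ℚ)))))))
       ≡ 1ℚ - (f a * f a + f b * f b - + 2 / 1 * f a * f b * (f c * f d)) * (+ 1 / 32)
  identity = solve-∀ ℚ-ring

private
  b₀ b₁ b₂ b₃ b₄ b₅ b₆ b₇ : F₂^ 3
  b₀ = false ∷ false ∷ false ∷ []
  b₁ = false ∷ false ∷ true ∷ []
  b₂ = false ∷ true ∷ false ∷ []
  b₃ = false ∷ true ∷ true ∷ []
  b₄ = true ∷ false ∷ false ∷ []
  b₅ = true ∷ false ∷ true ∷ []
  b₆ = true ∷ true ∷ false ∷ []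
  b₇ = true ∷ true ∷ true ∷ []

-- Every other pair reduces to π₁₂ with permuted densities: the permutation
-- only reorders the eight even bit patterns.
bound-sum : ∀ π p → sumQ (allVecs 3) (bound π p) ≡ 1ℚ - deficit π p
bound-sum π₁₂ p = bound-sum₁₂ (p ! i₁) (p ! i₂) (p ! i₃) (p ! i₄)
bound-sum π₁₃ p =
  trans (reorder (t b₀) (t b₁) (t b₂) (t b₃) (t b₄) (t b₅) (t b₆) (t b₇)) (bound-sum₁₂ (p ! i₁) (p ! i₃) (p ! i₂) (p ! i₄))
  where
  t = bound π₁₃ p
  reorder : ∀ t₀ t₁ t₂ t₃ t₄ t₅ t₆ t₇ → t₀ + (t₁ + (t₂ + (t₃ + (t₄ + (t₅ + (t₆ + (t₇ + 0ℚ)))))))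
                                       ≡ t₀ + (t₂ + (t₁ + (t₃ + (t₄ + (t₆ + (t₅ + (t₇ + 0ℚ)))))))
  reorder = solve-∀ ℚ-ring
bound-sum π₁₄ p =
  trans (reorder (t b₀) (t b₁) (t b₂) (t b₃) (t b₄) (t b₅) (t b₆) (t b₇)) (bound-sum₁₂ (p ! i₁) (p ! i₄) (p ! i₂) (p ! i₃))
  where
  t = bound π₁₄ p
  reorder : ∀ t₀ t₁ t₂ t₃ t₄ t₅ t₆ t₇ → t₀ + (t₁ + (t₂ + (t₃ + (t₄ + (t₅ + (t₆ + (t₇ + 0ℚ)))))))
                                       ≡ t₀ + (t₃ + (t₁ + (t₂ + (t₅ + (t₆ + (t₄ + (t₇ + 0ℚ)))))))
  reorder = solve-∀ ℚ-ring
bound-sum π₂₃ p =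
  trans (reorder (t b₀) (t b₁) (t b₂) (t b₃) (t b₄) (t b₅) (t b₆) (t b₇)) (bound-sum₁₂ (p ! i₂) (p ! i₃) (p ! i₁) (p ! i₄))
  where
  t = bound π₂₃ p
  reorder : ∀ t₀ t₁ t₂ t₃ t₄ t₅ t₆ t₇ → t₀ + (t₁ + (t₂ + (t₃ + (t₄ + (t₅ + (t₆ + (t₇ + 0ℚ)))))))
                                       ≡ t₀ + (t₄ + (t₁ + (t₅ + (t₂ + (t₆ + (t₃ + (t₇ + 0ℚ)))))))
  reorder = solve-∀ ℚ-ring
bound-sum π₂₄ p =
  trans (reorder (t b₀) (t b₁) (t b₂) (t b₃) (t b₄) (t b₅) (t b₆) (t b₇)) (bound-sum₁₂ (p ! i₂) (p ! i₄) (p ! i₁) (p ! i₃))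
  where
  t = bound π₂₄ p
  reorder : ∀ t₀ t₁ t₂ t₃ t₄ t₅ t₆ t₇ → t₀ + (t₁ + (t₂ + (t₃ + (t₄ + (t₅ + (t₆ + (t₇ + 0ℚ)))))))
                                       ≡ t₀ + (t₅ + (t₁ + (t₄ + (t₃ + (t₆ + (t₂ + (t₇ + 0ℚ)))))))
  reorder = solve-∀ ℚ-ring
bound-sum π₃₄ p =
  trans (reorder (t b₀) (t b₁) (t b₂) (t b₃) (t b₄) (t b₅) (t b₆) (t b₇)) (bound-sum₁₂ (p ! i₃) (p ! i₄) (p ! i₁) (p ! i₂))
  where
  t = bound π₃₄ p
  reorder : ∀ t₀ t₁ t₂ t₃ t₄ t₅ t₆ t₇ → t₀ + (t₁ + (t₂ + (t₃ + (t₄ + (t₅ + (t₆ + (t₇ + 0ℚ)))))))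
                                       ≡ t₀ + (t₆ + (t₂ + (t₄ + (t₃ + (t₅ + (t₁ + (t₇ + 0ℚ)))))))
  reorder = solve-∀ ℚ-ring

product-≤ : ∀ v → (∀ i → 0ℚ ≤ v ! i) → (∀ i → v ! i ≤ 1ℚ) → ∀ i → product v ≤ v ! i
product-≤ v 0≤v v≤1 i₁ =
  ≤-trans (*-≤ˡ 0≤v₁₂₃ (v≤1 i₄)) (≤-trans (*-≤ˡ 0≤v₁₂ (v≤1 i₃)) (*-≤ˡ (0≤v i₁) (v≤1 i₂)))
  where
  0≤v₁₂ = *-nonNeg (0≤v i₁) (0≤v i₂)
  0≤v₁₂₃ = *-nonNeg 0≤v₁₂ (0≤v i₃)
product-≤ v 0≤v v≤1 i₂ =
  ≤-trans (*-≤ˡ 0≤v₁₂₃ (v≤1 i₄)) (≤-trans (*-≤ˡ 0≤v₁₂ (v≤1 i₃)) (*-≤ʳ (v≤1 i₁) (0≤v i₂)))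
  where
  0≤v₁₂ = *-nonNeg (0≤v i₁) (0≤v i₂)
  0≤v₁₂₃ = *-nonNeg 0≤v₁₂ (0≤v i₃)
product-≤ v 0≤v v≤1 i₃ = ≤-trans (*-≤ˡ (*-nonNeg (*-nonNeg (0≤v i₁) (0≤v i₂)) (0≤v i₃)) (v≤1 i₄))
                                 (*-≤ʳ (≤-trans (*-≤ˡ (0≤v i₁) (v≤1 i₂)) (v≤1 i₁)) (0≤v i₃))
product-≤ v 0≤v v≤1 i₄ =
  *-≤ʳ (≤-trans (*-≤ˡ (*-nonNeg (0≤v i₁) (0≤v i₂)) (v≤1 i₃)) (≤-trans (*-≤ˡ (0≤v i₁) (v≤1 i₂)) (v≤1 i₁))) (0≤v i₄)

-- A dense popular piece

target : ℚ → ℚ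
target K = K - + 1 / 10000

scale : ℚ → ℚ
scale K = + 20 / 1 * K

mass-deficit : ∀ K G → 1ℚ ≤ K → + 1 / 640 ≤ K * G →
  (scale K ^ℚ 3 * (1ℚ - G) + + 8 / 1 * target K) * K < scale K ^ℚ 3 * target K
mass-deficit K G 1≤K 1/640≤KG = <-by-difference _ (certificate K G)
  (+-mono-≤-< (+-mono-≤ (*-nonNeg (^-nonNeg 3 0≤20K) (≤⇒0≤- 1/640≤KG)) (*-nonNeg (square-nonNeg K) (≤⇒0≤- 8≤117K/10)))
              (*-pos 0<K (positive⁻¹ (+ 1 / 1250))))
  where
  0<K : 0ℚ < K
  0<K = 1≤⇒pos 1≤K
  0≤20K : 0ℚ ≤ + 20 / 1 * K
  0≤20K = *-nonNeg (nonNegative⁻¹ (+ 20 / 1)) (<⇒≤ 0<K)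
  8≤117K/10 : + 8 / 1 ≤ + 117 / 10 * K
  8≤117K/10 = ≤-trans (≤ᵇ⇒≤ tt) (subst (_≤ + 117 / 10 * K) (*-identityʳ (+ 117 / 10)) (*-monoˡ-≤-nonNeg (+ 117 / 10) 1≤K))
  certificate : ∀ K G → let s = + 20 / 1 * K ; W = s * (s * (s * 1ℚ)) ; L = K - + 1 / 10000 in
    W * L - (W * (1ℚ - G) + + 8 / 1 * L) * K ≡ W * (K * G - + 1 / 640) + K * K * (+ 117 / 10 * K - + 8 / 1) + K * (+ 1 / 1250)
  certificate = solve-∀ ℚ-ring

sparse-piece : ∀ {s L P X q} → 0ℚ ≤ s → 0ℚ ≤ L → 0ℚ ≤ P → 0ℚ ≤ X → X * s ^ℚ 4 ≤ 1ℚ →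
               q ^ℚ 4 ≤ (P * X) ^ℚ 3 → (s ^ℚ 3 * L * q) ^ℚ 4 ≤ L ^ℚ 4 * P ^ℚ 3
sparse-piece {s} {L} {P} {X} {q} 0≤s 0≤L 0≤P 0≤X Xs⁴≤1 q⁴≤ = begin
  (s ^ℚ 3 * L * q) ^ℚ 4              ≡⟨ ^-distrib-* 4 (s ^ℚ 3 * L) q ⟩
  (s ^ℚ 3 * L) ^ℚ 4 * q ^ℚ 4         ≤⟨ *-monoˡ-≤′ (^-nonNeg 4 (*-nonNeg (^-nonNeg 3 0≤s) 0≤L)) q⁴≤ ⟩
  (s ^ℚ 3 * L) ^ℚ 4 * (P * X) ^ℚ 3   ≡⟨ regroup s L P X ⟩
  L ^ℚ 4 * P ^ℚ 3 * (X * s ^ℚ 4) ^ℚ 3 ≤⟨ *-monoˡ-≤′ (*-nonNeg (^-nonNeg 4 0≤L) (^-nonNeg 3 0≤P))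
                                          (^-mono-≤ 3 (*-nonNeg 0≤X (^-nonNeg 4 0≤s)) Xs⁴≤1) ⟩
  L ^ℚ 4 * P ^ℚ 3 * 1ℚ ^ℚ 3          ≡⟨ *-identityʳ (L ^ℚ 4 * P ^ℚ 3) ⟩
  L ^ℚ 4 * P ^ℚ 3                    ∎
  where
  open ≤-Reasoning
  regroup : ∀ s L P X →
    let cube : ℚ → ℚ
        cube x = x * (x * (x * 1ℚ))
        fourth : ℚ → ℚ
        fourth x = x * cube x
    in fourth (cube s * L) * cube (P * X) ≡ fourth L * cube P * cube (X * fourth s)
  regroup = solve-∀ ℚ-ring

unpopular-piece : ∀ {W L P X q c} → 0ℚ ≤ W → 0ℚ ≤ P → (q * L) ^ℚ 4 ≤ (P * X) ^ℚ 3 → X ^ℚ 3 ≤ c ^ℚ 4 →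
                  (W * L * q) ^ℚ 4 ≤ (W * c) ^ℚ 4 * P ^ℚ 3
unpopular-piece {W} {L} {P} {X} {q} {c} 0≤W 0≤P qL⁴≤ X³≤ = begin
  (W * L * q) ^ℚ 4              ≡⟨ regroup₁ W L q ⟩
  W ^ℚ 4 * (q * L) ^ℚ 4         ≤⟨ *-monoˡ-≤′ (^-nonNeg 4 0≤W) qL⁴≤ ⟩
  W ^ℚ 4 * (P * X) ^ℚ 3         ≡⟨ regroup₂ W P X ⟩
  W ^ℚ 4 * P ^ℚ 3 * X ^ℚ 3      ≤⟨ *-monoˡ-≤′ (*-nonNeg (^-nonNeg 4 0≤W) (^-nonNeg 3 0≤P)) X³≤ ⟩
  W ^ℚ 4 * P ^ℚ 3 * c ^ℚ 4      ≡⟨ regroup₃ W P c ⟩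
  (W * c) ^ℚ 4 * P ^ℚ 3         ∎
  where
  open ≤-Reasoning
  regroup₁ : ∀ W L q → (W * L * q) ^ℚ 4 ≡ W ^ℚ 4 * (q * L) ^ℚ 4
  regroup₁ W L q = trans (cong (_^ℚ 4) (swap W L q)) (^-distrib-* 4 W (q * L))
    where
    swap : ∀ a b c → a * b * c ≡ a * (c * b)
    swap = solve-∀ ℚ-ring
  regroup₂ : ∀ W P X → W ^ℚ 4 * (P * X) ^ℚ 3 ≡ W ^ℚ 4 * P ^ℚ 3 * X ^ℚ 3
  regroup₂ W P X = trans (cong (W ^ℚ 4 *_) (^-distrib-* 3 P X)) (sym (*-assoc (W ^ℚ 4) _ _))
  regroup₃ : ∀ W P c → W ^ℚ 4 * P ^ℚ 3 * c ^ℚ 4 ≡ (W * c) ^ℚ 4 * P ^ℚ 3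
  regroup₃ W P c = trans (swap (W ^ℚ 4) (P ^ℚ 3) (c ^ℚ 4)) (cong (_* P ^ℚ 3) (sym (^-distrib-* 4 W c)))
    where
    swap : ∀ a b c → a * b * c ≡ a * c * b
    swap = solve-∀ ℚ-ring

module _ (K : ℚ) (1≤K : 1ℚ ≤ K) (p : Quad ℚ) (0≤share : ∀ i b → 0ℚ ≤ share (p ! i) b)
         (P : ℚ) (0<P : 0ℚ < P) (Q : F₂^ 3 → ℚ) (0≤Q : ∀ b → 0ℚ ≤ Q b)
         (Q⁴≤ : ∀ b → Q b ^ℚ 4 ≤ (P * product (shares p b)) ^ℚ 3)
         (P³≤ : P ^ℚ 3 ≤ (sumQ (allVecs 3) Q * K) ^ℚ 4) where

  Dense : F₂^ 3 → Set
  Dense b = ∀ i → 1ℚ ≤ shares p b ! i * scale K ^ℚ 4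

  Popular : F₂^ 3 → Set
  Popular b = (P * product (shares p b)) ^ℚ 3 ≤ (Q b * target K) ^ℚ 4

  private
    B : List (F₂^ 3)
    B = allVecs 3
    L s W ΣQ : ℚ
    L = target K
    s = scale K
    W = s ^ℚ 3
    ΣQ = sumQ B Q

    0<K : 0ℚ < K
    0<K = 1≤⇒pos 1≤K
    0≤s : 0ℚ ≤ s
    0≤s = *-nonNeg (nonNegative⁻¹ (+ 20 / 1)) (<⇒≤ 0<K)
    0≤W : 0ℚ ≤ W
    0≤W = ^-nonNeg 3 0≤s
    0≤L : 0ℚ ≤ L
    0≤L = ≤⇒0≤- (≤-trans 1/10000≤1 1≤K)
      where
      1/10000≤1 : + 1 / 10000 ≤ 1ℚ
      1/10000≤1 = ≤ᵇ⇒≤ tt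

    dense? : ∀ b → Dec (Dense b)
    dense? b = all? λ i → 1ℚ ≤? shares p b ! i * s ^ℚ 4

    popular? : ∀ b → Dec (Popular b)
    popular? b = _ ≤? _

    0≤piece : ∀ b i → 0ℚ ≤ shares p b ! i
    0≤piece = shares-nonNeg 0≤share

    piece≤1 : ∀ b i → shares p b ! i ≤ 1ℚ
    piece≤1 = shares-≤1 0≤share

    amgm-piece : ∀ π b → product (shares p b) ^ℚ 3 ≤ bound π p b ^ℚ 4 × 0ℚ ≤ bound π p b
    amgm-piece π b =
      subst (λ x → x ^ℚ 3 ≤ bound π p b ^ℚ 4) (sym (product-pair π v)) (am-gm-gap ≤₁ ≤₂ ≤₃ ≤₄ ≤₅ ≤₆) ,
      amgmBound-nonNeg ≤₁ ≤₂ ≤₃ ≤₄ ≤₅ ≤₆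
      where
      v = shares p b
      ≤₁ = 0≤piece b (fst π)
      ≤₂ = piece≤1 b (fst π)
      ≤₃ = 0≤piece b (snd π)
      ≤₄ = piece≤1 b (snd π)
      ≤₅ = 0≤piece b (fstᶜ π)
      ≤₆ = 0≤piece b (sndᶜ π)

    raise : ∀ {x y} → 0ℚ ≤ x → x ≤ y → x ^ℚ 4 * P ^ℚ 3 ≤ y ^ℚ 4 * P ^ℚ 3
    raise 0≤x x≤y = *-monoʳ-≤′ (^-nonNeg 3 (<⇒≤ 0<P)) (^-mono-≤ 4 0≤x x≤y)

    piece-bound : ∀ π b → ¬ (Dense b × Popular b) → (W * L * Q b) ^ℚ 4 ≤ (W * bound π p b + L) ^ℚ 4 * P ^ℚ 3
    piece-bound π b ¬dense-popular = by-popularity (popular? b)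
      where
      c = bound π p b
      X = product (shares p b)
      0≤Wc : 0ℚ ≤ W * c
      0≤Wc = *-nonNeg 0≤W (proj₂ (amgm-piece π b))
      by-popularity : Dec (Popular b) → (W * L * Q b) ^ℚ 4 ≤ (W * c + L) ^ℚ 4 * P ^ℚ 3
      by-popularity (no unpopular) = ≤-trans
        (unpopular-piece 0≤W (<⇒≤ 0<P) (<⇒≤ (≰⇒> unpopular)) (proj₁ (amgm-piece π b)))
        (raise 0≤Wc (subst (_≤ W * c + L) (+-identityʳ (W * c)) (+-monoʳ-≤ (W * c) 0≤L)))
      by-popularity (yes popular) = Product.uncurry sparse
        (¬∀⟶∃¬ 4 _ (λ i → 1ℚ ≤? shares p b ! i * s ^ℚ 4) λ dense → ¬dense-popular (dense , popular))
        where
        sparse : ∀ i → ¬ (1ℚ ≤ shares p b ! i * s ^ℚ 4) → (W * L * Q b) ^ℚ 4 ≤ (W * c + L) ^ℚ 4 * P ^ℚ 3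
        sparse i thin = ≤-trans
          (sparse-piece 0≤s 0≤L (<⇒≤ 0<P) 0≤X (<⇒≤ (≤-<-trans Xs⁴≤ (≰⇒> thin))) (Q⁴≤ b))
          (raise 0≤L (subst (_≤ W * c + L) (+-identityˡ L) (+-monoˡ-≤ L 0≤Wc)))
          where
          0≤X : 0ℚ ≤ X
          0≤X = *-nonNeg (*-nonNeg (*-nonNeg (0≤piece b i₁) (0≤piece b i₂)) (0≤piece b i₃)) (0≤piece b i₄)
          Xs⁴≤ : X * s ^ℚ 4 ≤ shares p b ! i * s ^ℚ 4
          Xs⁴≤ = *-monoʳ-≤′ (^-nonNeg 4 0≤s) (product-≤ (shares p b) (0≤piece b) (piece≤1 b) i)

    0<ΣQ : 0ℚ < ΣQ
    0<ΣQ = *-cancelʳ-<-nonNeg K {{nonNegative (<⇒≤ 0<K)}} (subst (_< ΣQ * K) (sym (*-zeroˡ K))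
      (^-cancel-< 4 (*-nonNeg (sumQ-nonNeg B 0≤Q) (<⇒≤ 0<K))
        (subst (_< (ΣQ * K) ^ℚ 4) (sym (0^suc≡0 3)) (<-≤-trans (^-pos 3 0<P) P³≤))))

    total-mass : ∀ π → sumQ B (λ b → W * bound π p b + L) ≡ W * (1ℚ - deficit π p) + + 8 / 1 * L
    total-mass π = begin
      sumQ B (λ b → W * bound π p b + L)              ≡⟨ sumQ-+ B (λ b → W * bound π p b) (λ _ → L) ⟩
      sumQ B (λ b → W * bound π p b) + sumQ B (λ _ → L) ≡⟨ cong₂ _+_ (sumQ-*ˡ B W (bound π p)) (eight L) ⟩
      W * sumQ B (bound π p) + + 8 / 1 * L            ≡⟨ cong (λ x → W * x + + 8 / 1 * L) (bound-sum π p) ⟩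
      W * (1ℚ - deficit π p) + + 8 / 1 * L            ∎
      where
      open ≡-Reasoning
      eight : ∀ L → L + (L + (L + (L + (L + (L + (L + (L + 0ℚ))))))) ≡ + 8 / 1 * L
      eight = solve-∀ ℚ-ring

    total-bound : (∀ b → ¬ (Dense b × Popular b)) → ∀ π → W * L ≤ (W * (1ℚ - deficit π p) + + 8 / 1 * L) * K
    total-bound none π = subst (λ C → W * L ≤ C * K) (total-mass π) (*-cancelʳ-≤-pos ΣQ {{positive 0<ΣQ}} (begin
      W * L * ΣQ      ≤⟨ ^-cancel-≤ 3 (*-nonNeg 0≤C (*-nonNeg (sumQ-nonNeg B 0≤Q) (<⇒≤ 0<K))) fourth-powers ⟩
      C * (ΣQ * K)    ≡⟨ rearrange C ΣQ K ⟩
      C * K * ΣQ      ∎))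
      where
      open ≤-Reasoning
      C : ℚ
      C = sumQ B (λ b → W * bound π p b + L)
      0≤C : 0ℚ ≤ C
      0≤C = sumQ-nonNeg B λ b → +-mono-≤ (*-nonNeg 0≤W (proj₂ (amgm-piece π b))) 0≤L
      rearrange : ∀ a b c → a * (b * c) ≡ a * c * b
      rearrange = solve-∀ ℚ-ring
      fourth-powers : (W * L * ΣQ) ^ℚ 4 ≤ (C * (ΣQ * K)) ^ℚ 4
      fourth-powers = begin
        (W * L * ΣQ) ^ℚ 4                  ≡⟨ cong (_^ℚ 4) (sym (sumQ-*ˡ B (W * L) Q)) ⟩
        sumQ B (λ b → W * L * Q b) ^ℚ 4     ≤⟨ sumQ-root 3 B (λ b → *-nonNeg (*-nonNeg 0≤W 0≤L) (0≤Q b))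
                                                 (λ b → +-mono-≤ (*-nonNeg 0≤W (proj₂ (amgm-piece π b))) 0≤L)
                                                 (λ b → piece-bound π b (none b)) ⟩
        C ^ℚ 4 * P ^ℚ 3                    ≤⟨ *-monoˡ-≤′ (^-nonNeg 4 0≤C) P³≤ ⟩
        C ^ℚ 4 * (ΣQ * K) ^ℚ 4             ≡⟨ sym (^-distrib-* 4 C (ΣQ * K)) ⟩
        (C * (ΣQ * K)) ^ℚ 4                ∎

  dense-popular-piece : ∀ i j → 1ℚ ≤ + 2 / 1 * K * (bias (p ! i) * bias (p ! i)) →
                        bias (p ! j) * bias (p ! j) < + 81 / 100 → ∃ λ b → Dense b × Popular b
  dense-popular-piece i j i-biased j-unbiased = search (∃? 3 (λ b → dense? b ×-dec popular? b))
    where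
    f : Idx → ℚ
    f i = bias (p ! i)
    chosen : Σ Pair λ π → Covers f i π × Balanced f π
    chosen = choose-pair f (λ i → bias²≤1 (0≤share i false) (0≤share i true)) i j j-unbiased
    π : Pair
    π = proj₁ chosen
    regroup : ∀ K x → + 2 / 1 * K * x * (+ 1 / 640) ≡ K * (x * (+ 1 / 320))
    regroup = solve-∀ ℚ-ring
    fᵢ²/320≤G : f i * f i * (+ 1 / 320) ≤ deficit π p
    fᵢ²/320≤G = ≤-trans (*-monoʳ-≤-nonNeg (+ 1 / 320) (proj₁ (proj₂ chosen)))
                        (deficitOf-≥ (f (fst π)) (f (snd π)) (f (fstᶜ π) * f (sndᶜ π)) (proj₂ (proj₂ chosen)))
    1/640≤KG : + 1 / 640 ≤ K * deficit π p
    1/640≤KG = begin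
      + 1 / 640                                 ≡⟨ sym (*-identityˡ (+ 1 / 640)) ⟩
      1ℚ * (+ 1 / 640)                          ≤⟨ *-monoʳ-≤-nonNeg (+ 1 / 640) i-biased ⟩
      + 2 / 1 * K * (f i * f i) * (+ 1 / 640)   ≡⟨ regroup K (f i * f i) ⟩
      K * (f i * f i * (+ 1 / 320))             ≤⟨ *-monoˡ-≤′ (<⇒≤ 0<K) fᵢ²/320≤G ⟩
      K * deficit π p                           ∎
      where open ≤-Reasoning
    search : Dec (∃ λ b → Dense b × Popular b) → ∃ λ b → Dense b × Popular b
    search (yes found) = found
    search (no none)   =
      ⊥-elim (<⇒≱ (mass-deficit K (deficit π p) 1≤K 1/640≤KG) (total-bound (λ b dp → none (b , dp)) π))

dense⇒large : ∀ {K S v} → 1ℚ ≤ K → 0ℚ ≤ S → 0ℚ ≤ v → 1ℚ ≤ v * scale K ^ℚ 4 →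
              + 1 / 160000 * S ≤ K ^ℚ 10 * (S * v)
dense⇒large {K} {S} {v} 1≤K 0≤S 0≤v dense = begin
  + 1 / 160000 * S                          ≡⟨ sym (*-identityʳ _) ⟩
  + 1 / 160000 * S * 1ℚ                     ≤⟨ *-monoˡ-≤′ (*-nonNeg (nonNegative⁻¹ (+ 1 / 160000)) 0≤S) dense ⟩
  + 1 / 160000 * S * (v * scale K ^ℚ 4)     ≡⟨ regroup K S v ⟩
  K ^ℚ 4 * (S * v)                          ≤⟨ *-monoʳ-≤′ (*-nonNeg 0≤S 0≤v) K⁴≤K¹⁰ ⟩
  K ^ℚ 10 * (S * v)                         ∎
  where
  open ≤-Reasoning
  regroup : ∀ K S v → let fourth : ℚ → ℚ
                          fourth x = x * (x * (x * (x * 1ℚ)))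
                      in + 1 / 160000 * S * (v * fourth (+ 20 / 1 * K)) ≡ fourth K * (S * v)
  regroup = solve-∀ ℚ-ring
  split : ∀ K → let k⁴ = K * (K * (K * (K * 1ℚ))) ; k⁶ = K * (K * k⁴) in k⁴ * k⁶ ≡ K * (K * (K * (K * k⁶)))
  split = solve-∀ ℚ-ring
  K⁴≤K¹⁰ : K ^ℚ 4 ≤ K ^ℚ 10
  K⁴≤K¹⁰ = subst₂ _≤_ (*-identityʳ (K ^ℚ 4)) (split K)
    (*-monoˡ-≤′ (^-nonNeg 4 (≤-trans (≤ᵇ⇒≤ tt) 1≤K)) (^-≥1 6 1≤K))

Each : (Idx → Set) → Set
Each P = P i₁ × P i₂ × P i₃ × P i₄

each? : ∀ {P : Idx → Set} → (∀ i → Dec (P i)) → Dec (Each P)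
each? P? = P? i₁ ×-dec P? i₂ ×-dec P? i₃ ×-dec P? i₄

non-flat-witness : ∀ {n} δ² (A : Quad (Subset n)) → ¬ CoherentlyFlat δ² (A ! i₁) (A ! i₂) (A ! i₃) (A ! i₄) →
  ∃ λ ξ → (∃ λ i → InSpec δ² (A ! i) ξ) × (∃ λ j → ¬ InSpec (+ 81 / 100) (A ! j) ξ)
non-flat-witness {n} δ² A ¬flat = ξ , biased , unbiased
  where
  FlatAt : F₂^ n → Set
  FlatAt ξ = Each (λ i → InSpec (+ 81 / 100) (A ! i) ξ) ⊎ Each (λ i → ¬ InSpec δ² (A ! i) ξ)
  inSpec? : ∀ α² i ξ → Dec (InSpec α² (A ! i) ξ)
  inSpec? α² i ξ = _ ≤? _
  flat-at? : ∀ ξ → Dec (FlatAt ξ)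
  flat-at? ξ = each? (λ i → inSpec? (+ 81 / 100) i ξ) ⊎-dec each? (λ i → ¬? (inSpec? δ² i ξ))
  ξ,¬flat : ∃ λ ξ → ¬ FlatAt ξ
  ξ,¬flat = ¬∀⇒∃¬ n flat-at? ¬flat
  ξ : F₂^ n
  ξ = proj₁ ξ,¬flat
  unbiased : ∃ λ j → ¬ InSpec (+ 81 / 100) (A ! j) ξ
  unbiased = ¬∀⟶∃¬ 4 _ (λ j → inSpec? (+ 81 / 100) j ξ)
    λ all → proj₂ ξ,¬flat (inj₁ (all i₁ , all i₂ , all i₃ , all i₄))
  biased : ∃ λ i → InSpec δ² (A ! i) ξ
  biased = Product.map₂ (λ {i} → decidable-stable (inSpec? δ² i ξ))
    (¬∀⟶∃¬ 4 _ (λ i → ¬? (inSpec? δ² i ξ)) λ none → proj₂ ξ,¬flat (inj₂ (none i₁ , none i₂ , none i₃ , none i₄)))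

module _ {n : ℕ} (K : ℚ) (1≤K : 1ℚ ≤ K) (A : Quad (Subset n)) (A≢∅ : ∀ i → NonEmpty (A ! i))
         (ω≥ : ωAtLeastInv (A ! i₁) (A ! i₂) (A ! i₃) (A ! i₄) K) (ξ : F₂^ n) where

  private
    p : Quad ℚ
    p = ⟨ density (A ! i₁) ξ , density (A ! i₂) ξ , density (A ! i₃) ξ , density (A ! i₄) ξ ⟩

    p-! : ∀ i → p ! i ≡ density (A ! i) ξ
    p-! i₁ = refl
    p-! i₂ = refl
    p-! i₃ = refl
    p-! i₄ = refl

    S : Idx → ℚ
    S i = ℕ→ℚ (card (A ! i))

    P : ℚ
    P = ℕ→ℚ (cardProduct A)

    Q : F₂^ 3 → ℚ
    Q b = ℕ→ℚ (quadCount (slices A ξ b))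

    ℕ→ℚ-cardProduct : ∀ (A : Quad (Subset n)) →
      ℕ→ℚ (cardProduct A) ≡ ℕ→ℚ (card (A ! i₁)) * ℕ→ℚ (card (A ! i₂)) * ℕ→ℚ (card (A ! i₃)) * ℕ→ℚ (card (A ! i₄))
    ℕ→ℚ-cardProduct A = begin
      ℕ→ℚ (c₁ ℕ.* c₂ ℕ.* c₃ ℕ.* c₄)                     ≡⟨ ℕ→ℚ-* (c₁ ℕ.* c₂ ℕ.* c₃) c₄ ⟩
      ℕ→ℚ (c₁ ℕ.* c₂ ℕ.* c₃) * ℕ→ℚ c₄                  ≡⟨ cong (_* ℕ→ℚ c₄) (ℕ→ℚ-* (c₁ ℕ.* c₂) c₃) ⟩
      ℕ→ℚ (c₁ ℕ.* c₂) * ℕ→ℚ c₃ * ℕ→ℚ c₄                ≡⟨ cong (λ x → x * ℕ→ℚ c₃ * ℕ→ℚ c₄) (ℕ→ℚ-* c₁ c₂) ⟩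
      ℕ→ℚ c₁ * ℕ→ℚ c₂ * ℕ→ℚ c₃ * ℕ→ℚ c₄               ∎
      where
      open ≡-Reasoning
      c₁ = card (A ! i₁)
      c₂ = card (A ! i₂)
      c₃ = card (A ! i₃)
      c₄ = card (A ! i₄)

    card-piece : ∀ b i → ℕ→ℚ (card (slices A ξ b ! i)) ≡ S i * shares p b ! i
    card-piece b i₁ = card-slice (A ! i₁) ξ (A≢∅ i₁) (evenExtension b ! i₁)
    card-piece b i₂ = card-slice (A ! i₂) ξ (A≢∅ i₂) (evenExtension b ! i₂)
    card-piece b i₃ = card-slice (A ! i₃) ξ (A≢∅ i₃) (evenExtension b ! i₃)
    card-piece b i₄ = card-slice (A ! i₄) ξ (A≢∅ i₄) (evenExtension b ! i₄)

    cardProduct-pieces : ∀ b → ℕ→ℚ (cardProduct (slices A ξ b)) ≡ P * product (shares p b)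
    cardProduct-pieces b = begin
      ℕ→ℚ (cardProduct (slices A ξ b))
        ≡⟨ ℕ→ℚ-cardProduct (slices A ξ b) ⟩
      ℕ→ℚ (card (B ! i₁)) * ℕ→ℚ (card (B ! i₂)) * ℕ→ℚ (card (B ! i₃)) * ℕ→ℚ (card (B ! i₄))
        ≡⟨ cong₂ _*_ (cong₂ _*_ (cong₂ _*_ (card-piece b i₁) (card-piece b i₂)) (card-piece b i₃)) (card-piece b i₄) ⟩
      S i₁ * v ! i₁ * (S i₂ * v ! i₂) * (S i₃ * v ! i₃) * (S i₄ * v ! i₄)
        ≡⟨ regroup (S i₁) (S i₂) (S i₃) (S i₄) (v ! i₁) (v ! i₂) (v ! i₃) (v ! i₄) ⟩
      S i₁ * S i₂ * S i₃ * S i₄ * product v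
        ≡⟨ cong (_* product v) (sym (ℕ→ℚ-cardProduct A)) ⟩
      P * product v ∎
      where
      open ≡-Reasoning
      B = slices A ξ b
      v = shares p b
      regroup : ∀ S₁ S₂ S₃ S₄ v₁ v₂ v₃ v₄ →
                S₁ * v₁ * (S₂ * v₂) * (S₃ * v₃) * (S₄ * v₄) ≡ S₁ * S₂ * S₃ * S₄ * (v₁ * v₂ * v₃ * v₄)
      regroup = solve-∀ ℚ-ring

    0≤share : ∀ i b → 0ℚ ≤ share (p ! i) b
    0≤share i b = subst (λ x → 0ℚ ≤ share x b) (sym (p-! i)) (share-nonNeg (A ! i) ξ (A≢∅ i) b)

    0<P : 0ℚ < P
    0<P = subst (0ℚ <_) (sym (ℕ→ℚ-cardProduct A))
      (*-pos (*-pos (*-pos (card-pos _ (A≢∅ i₁)) (card-pos _ (A≢∅ i₂))) (card-pos _ (A≢∅ i₃))) (card-pos _ (A≢∅ i₄)))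

    Q⁴≤ : ∀ b → Q b ^ℚ 4 ≤ (P * product (shares p b)) ^ℚ 3
    Q⁴≤ b = subst₂ _≤_ (ℕ→ℚ-^ (quadCount B) 4) (trans (ℕ→ℚ-^ (cardProduct B) 3) (cong (_^ℚ 3) (cardProduct-pieces b)))
      (ℕ→ℚ-mono-≤ (additiveQuads⁴≤cards³ (B ! i₁) (B ! i₂) (B ! i₃) (B ! i₄)))
      where B = slices A ξ b

    P³≤ : P ^ℚ 3 ≤ (sumQ (allVecs 3) Q * K) ^ℚ 4
    P³≤ = subst (λ x → P ^ℚ 3 ≤ (x * K) ^ℚ 4)
      (trans (cong ℕ→ℚ (quadCount-slices A ξ)) (ℕ→ℚ-sumL (allVecs 3) (quadCount ∘ slices A ξ))) ω≥

  large-popular-slices : ∀ i j → InSpec (recip (+ 2 / 1 * K)) (A ! i) ξ → ¬ InSpec (+ 81 / 100) (A ! j) ξ →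
    ∃ λ b → let B = slices A ξ b in
      (∀ i → + 1 / 160000 * ℕ→ℚ (card (A ! i)) ≤ K ^ℚ 10 * ℕ→ℚ (card (B ! i)))
      × ωAtLeastInv (B ! i₁) (B ! i₂) (B ! i₃) (B ! i₄) (target K)
  large-popular-slices i j i∈ j∉ =
    let b , dense , popular = dense-popular-piece K 1≤K p 0≤share P 0<P Q 0≤Q Q⁴≤ P³≤ i j i-biased j-unbiased
    in b , large b dense , popular⇒ω b popular
    where
    0≤Q : ∀ b → 0ℚ ≤ Q b
    0≤Q b = ℕ→ℚ-nonNeg (quadCount (slices A ξ b))
    0<2K : 0ℚ < + 2 / 1 * K
    0<2K = *-pos (positive⁻¹ (+ 2 / 1)) (1≤⇒pos 1≤K)
    i-biased : 1ℚ ≤ + 2 / 1 * K * (bias (p ! i) * bias (p ! i))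
    i-biased = subst₂ _≤_ (*-recip _ 0<2K) (cong (λ x → + 2 / 1 * K * (bias x * bias x)) (sym (p-! i)))
      (*-monoˡ-≤′ (<⇒≤ 0<2K) (InSpec⇒≤bias² (A ! i) ξ (A≢∅ i) i∈))
    j-unbiased : bias (p ! j) * bias (p ! j) < + 81 / 100
    j-unbiased = ≰⇒> λ 81/100≤ → j∉ (≤bias²⇒InSpec (A ! j) ξ (A≢∅ j)
      (subst (λ x → + 81 / 100 ≤ bias x * bias x) (p-! j) 81/100≤))
    large : ∀ b → (∀ i → 1ℚ ≤ shares p b ! i * scale K ^ℚ 4) →
            ∀ i → + 1 / 160000 * S i ≤ K ^ℚ 10 * ℕ→ℚ (card (slices A ξ b ! i))
    large b dense i = subst (λ x → + 1 / 160000 * S i ≤ K ^ℚ 10 * x) (sym (card-piece b i))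
      (dense⇒large 1≤K (ℕ→ℚ-nonNeg (card (A ! i))) (shares-nonNeg 0≤share b i) (dense i))
    popular⇒ω : ∀ b → (P * product (shares p b)) ^ℚ 3 ≤ (Q b * target K) ^ℚ 4 →
                ωAtLeastInv (slices A ξ b ! i₁) (slices A ξ b ! i₂) (slices A ξ b ! i₃) (slices A ξ b ! i₄) (target K)
    popular⇒ω b = subst (λ x → x ^ℚ 3 ≤ (Q b * target K) ^ℚ 4) (sym (cardProduct-pieces b))

lemma4p2 : Σ[ c ∈ ℚ ] (0ℚ < c ×
  (∀ (n : ℕ) (K : ℚ) → 1ℚ ≤ K →
   (A₁ A₂ A₃ A₄ : Subset n) →
   NonEmpty A₁ → NonEmpty A₂ → NonEmpty A₃ → NonEmpty A₄ →
   ωAtLeastInv A₁ A₂ A₃ A₄ K →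
   ¬ CoherentlyFlat (recip ((+ 2 / 1) * K)) A₁ A₂ A₃ A₄ →
   Σ[ B₁ ∈ Subset n ] Σ[ B₂ ∈ Subset n ] Σ[ B₃ ∈ Subset n ] Σ[ B₄ ∈ Subset n ]
     ((B₁ ⊆ A₁ × B₂ ⊆ A₂ × B₃ ⊆ A₃ × B₄ ⊆ A₄) ×
      (c * ℕ→ℚ (card A₁) ≤ (K ^ℚ 10) * ℕ→ℚ (card B₁) ×
       c * ℕ→ℚ (card A₂) ≤ (K ^ℚ 10) * ℕ→ℚ (card B₂) ×
       c * ℕ→ℚ (card A₃) ≤ (K ^ℚ 10) * ℕ→ℚ (card B₃) ×
       c * ℕ→ℚ (card A₄) ≤ (K ^ℚ 10) * ℕ→ℚ (card B₄)) ×
      ωAtLeastInv B₁ B₂ B₃ B₄ (K - (+ 1 / 10000)))))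
lemma4p2 = + 1 / 160000 , positive⁻¹ (+ 1 / 160000) ,
  λ n K 1≤K A₁ A₂ A₃ A₄ A₁≢∅ A₂≢∅ A₃≢∅ A₄≢∅ ω≥ ¬flat →
    let A = ⟨ A₁ , A₂ , A₃ , A₄ ⟩
        ξ , (i , i∈) , (j , j∉) = non-flat-witness (recip (+ 2 / 1 * K)) A ¬flat
        A≢∅ = λ { i₁ → A₁≢∅ ; i₂ → A₂≢∅ ; i₃ → A₃≢∅ ; i₄ → A₄≢∅ }
        b , large , ω = large-popular-slices K 1≤K A A≢∅ ω≥ ξ i j i∈ j∉
        B = slices A ξ b
    in B ! i₁ , B ! i₂ , B ! i₃ , B ! i₄
     , (slice-⊆ A₁ ξ _ , slice-⊆ A₂ ξ _ , slice-⊆ A₃ ξ _ , slice-⊆ A₄ ξ _)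
     , (large i₁ , large i₂ , large i₃ , large i₄)
     , ω
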